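{- Let $n$ and $k$ be integers with $0\le k<n-1$, and let $\Gamma$ be a connected simple graph of order $n$ with exactly $k$ bridges such that $SO(\Gamma)\le SO(\Gamma')$ for every connected simple graph $\Gamma'$ of order $n$ with exactly $k$ bridges. Then $\Gamma$ has a unique cycle, and this cycle has length $n-k$.
   Context: The Sombor index of a graph $\Gamma$ is $SO(\Gamma)=\sum_{uv\in E(\Gamma)}\sqrt{\deg_\Gamma(u)^2+\deg_\Gamma(v)^2}$. A bridge is an edge whose deletion disconnects the graph. -}

module Defs where

open import Data.Bool using (Bool; true; false; if_then_else_; _∧_)
open import Data.Nat using (ℕ; zero; suc; _+_; _*_; _≤_; _≤ᵇ_; _<ᵇ_)
open import Data.Fin using (Fin; toℕ) renaming (_<_ to _<F_)
open import Data.List using (List; []; _∷_; _++_; zip; map; length; allFin; concatMap; filterᵇ)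
open import Data.Nat.ListAction using (sum)
open import Data.List.Relation.Unary.All using (All)
open import Data.List.Relation.Unary.Unique.Propositional using (Unique)
open import Data.List.Membership.Propositional using (_∈_)
open import Data.Product using (_×_; _,_)
open import Data.Sum using (_⊎_)
open import Relation.Binary.PropositionalEquality using (_≡_)
open import Relation.Nullary using (¬_)

record Graph (n : ℕ) : Set where
  field
    adj    : Fin n → Fin n → Bool
    sym    : ∀ i j → adj i j ≡ adj j i
    irrefl : ∀ i → adj i i ≡ false
open Graph public

Adj : ∀ {n} → Graph n → Fin n → Fin n → Set
Adj G i j = adj G i j ≡ true

data Reach {n : ℕ} (R : Fin n → Fin n → Set) : Fin n → Fin n → Set where
  here : ∀ {u} → Reach R u u
  step : ∀ {u v w} → R u v → Reach R v w → Reach R u w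

Connected : ∀ {n} → Graph n → Set
Connected G = ∀ u v → Reach (Adj G) u v

AdjMinus : ∀ {n} → Graph n → Fin n → Fin n → Fin n → Fin n → Set
AdjMinus G u v a b = Adj G a b × ¬ ((a ≡ u × b ≡ v) ⊎ (a ≡ v × b ≡ u))

IsBridge : ∀ {n} → Graph n → Fin n → Fin n → Set
IsBridge G u v = Adj G u v × ¬ Reach (AdjMinus G u v) u v

edges : ∀ {n} → Graph n → List (Fin n × Fin n)
edges {n} G = concatMap (λ i → map (λ j → (i , j))
                 (filterᵇ (λ j → (toℕ i <ᵇ toℕ j) ∧ adj G i j) (allFin n))) (allFin n)

deg : ∀ {n} → Graph n → Fin n → ℕ
deg {n} G i = length (filterᵇ (λ j → adj G i j) (allFin n))

-- integer square root: isqrt m = ⌊√m⌋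
isqrtGo : ℕ → ℕ → ℕ
isqrtGo m zero = zero
isqrtGo m (suc r) = if (suc r * suc r) ≤ᵇ m then suc r else isqrtGo m r

isqrt : ℕ → ℕ
isqrt m = isqrtGo m m

-- SOfloor G N = Σ_{uv ∈ E} ⌊ N · √(deg u² + deg v²) ⌋,
-- so  SOfloor G N ≤ N·SO(G) < SOfloor G N + |E(G)|  (for N ≥ 1 and |E| > 0).
SOfloor : ∀ {n} → Graph n → ℕ → ℕ
SOfloor G N = sum (map (λ e → isqrt ((deg G (Data.Product.proj₁ e) * deg G (Data.Product.proj₁ e)
                                     + deg G (Data.Product.proj₂ e) * deg G (Data.Product.proj₂ e)) * N * N))
                       (edges G))

-- SO(G) ≤ SO(H) as real numbers, expressed via exact rational approximations:
-- SO(G) ≤ SO(H)  iff  for every N, ⌊N·SO⌋-approximations satisfy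
-- SOfloor G N ≤ SOfloor H N + |E(H)|.
SO≤ : ∀ {n m} → Graph n → Graph m → Set
SO≤ G H = ∀ N → SOfloor G N ≤ SOfloor H N + length (edges H)

-- Cycles: a cycle v₀ v₁ … v_{m-1} (m ≥ 3, distinct vertices) with
-- v_i ~ v_{i+1} and v_{m-1} ~ v₀.  cycPairs lists the consecutive pairs.
cycPairs : ∀ {n} → List (Fin n) → List (Fin n × Fin n)
cycPairs [] = []
cycPairs (v ∷ vs) = zip (v ∷ vs) (vs ++ (v ∷ []))

IsCycle : ∀ {n} → Graph n → List (Fin n) → Set
IsCycle G vs = 3 ≤ length vs × Unique vs
             × All (λ p → Adj G (Data.Product.proj₁ p) (Data.Product.proj₂ p)) (cycPairs vs)

CycEdge : ∀ {n} → List (Fin n) → Fin n → Fin n → Set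
CycEdge vs a b = ((a , b) ∈ cycPairs vs) ⊎ ((b , a) ∈ cycPairs vs)

-- two cycles are the same (as subgraphs) iff they have the same edge set
SameCycle : ∀ {n} → List (Fin n) → List (Fin n) → Set
SameCycle C D = ∀ a b → (CycEdge C a b → CycEdge D a b) × (CycEdge D a b → CycEdge C a b)

HasBridges : ∀ {n} → Graph n → ℕ → Set
HasBridges {n} G k = Data.Product.Σ (List (Fin n × Fin n)) λ L →
  Unique L × length L ≡ k ×
  (∀ u v → (((u , v) ∈ L) → (u <F v × IsBridge G u v)) × ((u <F v × IsBridge G u v) → (u , v) ∈ L))

-- Γ is connected with k < n − 1 bridges, so it is not a tree: it has m ≥ n edges, and an edge
-- outside a spanning tree closes a cycle C.  Sending each bridge to its endpoint on the far side
-- from C is injective and misses C, so |C| + k ≤ n.  The tadpole graph (a cycle with a pendant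
-- path of k edges) has at most n edges and maximum degree 3, and comparing
-- SO(Γ) ≥ Σᵥ deg(v)²/√2 ≥ (8m − 4n)/√2 with SO(tadpole) ≤ √8·n + 3(4 − √8) shows that a
-- minimiser has m ≤ n.  Then no two distinct edges can be deleted one after the other without
-- disconnecting Γ, since a spanning tree of what remains would force m ≥ n + 1.  Hence every edge
-- off a cycle is a bridge: all cycles have the edges of C, and n ≤ m ≤ k + |C| gives |C| = n − k.

module Submission where

open import Defs hiding (sym)
open import Data.Bool using (Bool; true; false; T; _∧_; if_then_else_)
open import Data.Bool.Properties using (T-≡; T-∧)
open import Data.Empty using (⊥-elim)
open import Data.Fin using (Fin; toℕ; fromℕ<) renaming (_≟_ to _≟F_)
import Data.Fin as Fin
open import Data.Fin.Properties using (toℕ-injective; toℕ-fromℕ<; fromℕ<-toℕ; toℕ<n)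
open import Data.List using (List; []; _∷_; _++_; [_]; length; zip; initLast; _∷ʳ′_; map; concatMap; allFin; filterᵇ)
open import Data.List.Properties
  using (length-map; length-++; length-++-sucʳ; length-++-comm; length-tabulate; ++-assoc; ++-identityʳ; map-++; map-tabulate)
open import Data.List.Membership.Propositional using (_∈_; _∉_; lose; find)
open import Data.List.Membership.Propositional.Properties
  using (∈-∃++; ∈-++⁻; ∈-++⁺ˡ; ∈-++⁺ʳ; ∈-allFin; ∈-map⁺; ∈-map⁻; ∈-filter⁺; ∈-filter⁻;
         ∈-concatMap⁺; ∈-concatMap⁻)
import Data.List.Membership.DecPropositional as DecMembership
open import Data.List.Relation.Binary.Disjoint.Propositional using (Disjoint)
open import Data.List.Relation.Binary.Subset.Propositional using (_⊆_)
open import Data.List.Relation.Unary.All using (All; []; _∷_; all?; lookup; tabulate) renaming (map to All-map)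
open import Data.List.Relation.Unary.All.Properties.Core using (¬Any⇒All¬; ¬All⇒Any¬)
open import Data.List.Relation.Unary.AllPairs using ([]; _∷_)
open import Data.List.Relation.Unary.Any using (here; there; satisfied)
open import Data.List.Relation.Unary.Unique.Propositional using (Unique)
open import Data.List.Relation.Unary.Unique.Propositional.Properties using (allFin⁺; filter⁺; map⁺; ++⁺; Unique[x∷xs]⇒x∉xs)
open import Data.Nat using (ℕ; zero; suc; pred; _+_; _*_; _∸_; _≤_; _<_; z≤n; s≤s; _≟_; _≤?_; _≤ᵇ_; _<ᵇ_)
open import Data.Nat.ListAction using (sum)
open import Data.Nat.ListAction.Properties using (sum-++)
open import Data.Nat.Properties
open import Data.Nat.Tactic.RingSolver using (solve-∀)
open import Data.Product using (Σ; ∃; _×_; _,_; proj₁; proj₂)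
open import Data.Product.Properties using (≡-dec)
open import Data.Sum using (_⊎_; inj₁; inj₂)
open import Function using (_∘_; flip; case_of_)
open import Function.Bundles using (Equivalence)
open import Relation.Binary using (tri<; tri≈; tri>)
open import Relation.Binary.PropositionalEquality
  using (_≡_; _≢_; refl; sym; trans; cong; cong₂; subst; subst₂; module ≡-Reasoning)
open import Relation.Nullary using (¬_; Dec; yes; no; does)
open import Relation.Nullary.Decidable using (T?; dec-true; dec-false; _×-dec_; _⊎-dec_)

module _ {A : Set} where

  ∈-++-∷⁻ : ∀ ys zs {x z : A} → z ∈ ys ++ x ∷ zs → z ≢ x → z ∈ ys ++ zs
  ∈-++-∷⁻ ys zs z∈ z≢x with ∈-++⁻ ys z∈
  ... | inj₁ z∈ys = ∈-++⁺ˡ z∈ys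
  ... | inj₂ (here z≡x) = ⊥-elim (z≢x z≡x)
  ... | inj₂ (there z∈zs) = ∈-++⁺ʳ ys z∈zs

  Unique-length-≤ : {xs ys : List A} → Unique xs → xs ⊆ ys → length xs ≤ length ys
  Unique-length-≤ {[]} _ _ = z≤n
  Unique-length-≤ {x ∷ xs} (x∉ ∷ u) xs⊆ys with ∈-∃++ (xs⊆ys (here refl))
  ... | ys₁ , ys₂ , refl = subst (suc (length xs) ≤_) (sym (length-++-sucʳ ys₁ x ys₂))
        (s≤s (Unique-length-≤ u λ z∈xs →
          ∈-++-∷⁻ ys₁ ys₂ (xs⊆ys (there z∈xs)) λ z≡x → lookup x∉ z∈xs (sym z≡x)))

  ∉⇒Unique-∷ : ∀ {x : A} {xs} → x ∉ xs → Unique xs → Unique (x ∷ xs)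
  ∉⇒Unique-∷ {xs = xs} x∉ u = ¬Any⇒All¬ xs x∉ ∷ u

  Unique-++⁻ : ∀ (xs : List A) {ys} → Unique (xs ++ ys) → Unique xs × Unique ys × Disjoint xs ys
  Unique-++⁻ [] u = [] , u , λ ()
  Unique-++⁻ (x ∷ xs) (px ∷ u) with Unique-++⁻ xs u
  ... | uxs , uys , disj = ∉⇒Unique-∷ (x∉ ∘ ∈-++⁺ˡ) uxs , uys , disj′
    where
    x∉ : x ∉ xs ++ _
    x∉ = Unique[x∷xs]⇒x∉xs (px ∷ u)
    disj′ : Disjoint (x ∷ xs) _
    disj′ (here refl , x∈ys) = x∉ (∈-++⁺ʳ xs x∈ys)
    disj′ (there z∈xs , z∈ys) = disj (z∈xs , z∈ys)

  Unique-++-comm : ∀ (xs ys : List A) → Unique (xs ++ ys) → Unique (ys ++ xs)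
  Unique-++-comm xs ys u with Unique-++⁻ xs u
  ... | uxs , uys , disj = ++⁺ uys uxs (λ (z∈ys , z∈xs) → disj (z∈xs , z∈ys))

  Unique-map⁺-on : ∀ {B : Set} {f : A → B} {xs} → (∀ {x y} → x ∈ xs → y ∈ xs → f x ≡ f y → x ≡ y) →
                   Unique xs → Unique (map f xs)
  Unique-map⁺-on {xs = []} _ _ = []
  Unique-map⁺-on {f = f} {x ∷ xs} injective (px ∷ u) =
    tabulate fx∉ ∷ Unique-map⁺-on (λ x∈ y∈ → injective (there x∈) (there y∈)) u
    where
    fx∉ : ∀ {z} → z ∈ map f xs → f x ≢ z
    fx∉ z∈ fx≡z with ∈-map⁻ f z∈
    ... | y , y∈ , refl = lookup px y∈ (injective (here refl) (there y∈) fx≡z)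

length-allFin : ∀ n → length (allFin n) ≡ n
length-allFin n = length-tabulate (λ i → i)

_∈ᵥ?_ : ∀ {n} (x : Fin n) xs → Dec (x ∈ xs)
_∈ᵥ?_ = DecMembership._∈?_ _≟F_

length<⇒∃∉ : ∀ {n} (S : List (Fin n)) → length S < n → ∃ (_∉ S)
length<⇒∃∉ {n} S |S|<n with all? (_∈ᵥ? S) (allFin n)
... | yes all∈ = ⊥-elim (<⇒≱ |S|<n (subst (_≤ length S) (length-allFin n) (Unique-length-≤ (allFin⁺ n) (lookup all∈))))
... | no ¬all∈ = satisfied (¬All⇒Any¬ (_∈ᵥ? S) (allFin n) ¬all∈)

module _ {A : Set} where

  consecutive : List A → List (A × A)
  consecutive (x ∷ y ∷ r) = (x , y) ∷ consecutive (y ∷ r)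
  consecutive _ = []

  lastOr : A → List A → A
  lastOr u [] = u
  lastOr u (x ∷ xs) = lastOr x xs

  lastOr-∷ʳ : ∀ (u : A) zs z → lastOr u (zs ++ [ z ]) ≡ z
  lastOr-∷ʳ u [] z = refl
  lastOr-∷ʳ u (w ∷ zs) z = lastOr-∷ʳ w zs z

  lastOr-++-∷ : ∀ (ys : List A) x u zs → lastOr x (ys ++ u ∷ zs) ≡ lastOr u zs
  lastOr-++-∷ [] x u zs = refl
  lastOr-++-∷ (y ∷ ys) x u zs = lastOr-++-∷ ys y u zs

  consecutive-∷ʳ : ∀ (u : A) xs z → consecutive (u ∷ xs ++ [ z ]) ≡ consecutive (u ∷ xs) ++ [ (lastOr u xs , z) ]
  consecutive-∷ʳ u [] z = refl
  consecutive-∷ʳ u (x ∷ xs) z = cong ((u , x) ∷_) (consecutive-∷ʳ x xs z)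

  consecutive-++ʳ : ∀ (xs ys : List A) → consecutive ys ⊆ consecutive (xs ++ ys)
  consecutive-++ʳ [] ys p∈ = p∈
  consecutive-++ʳ (x ∷ xs) ys p∈ with xs ++ ys | consecutive-++ʳ xs ys p∈
  ... | y ∷ r | p∈′ = there p∈′

  ∈-consecutive⁻ : ∀ (xs : List A) {a b} → (a , b) ∈ consecutive xs → ∃ λ ys → ∃ λ zs → xs ≡ ys ++ a ∷ b ∷ zs
  ∈-consecutive⁻ (x ∷ y ∷ r) (here refl) = [] , r , refl
  ∈-consecutive⁻ (x ∷ y ∷ r) (there p∈) with ∈-consecutive⁻ (y ∷ r) p∈
  ... | ys , zs , eq = x ∷ ys , zs , cong (x ∷_) eq

  length-consecutive : ∀ (x : A) r → length (consecutive (x ∷ r)) ≡ length r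
  length-consecutive x [] = refl
  length-consecutive x (y ∷ r) = cong suc (length-consecutive y r)

  zip-consecutive : ∀ (x : A) r v → zip (x ∷ r) (r ++ [ v ]) ≡ consecutive (x ∷ r ++ [ v ])
  zip-consecutive x [] v = refl
  zip-consecutive x (y ∷ r) v = cong ((x , y) ∷_) (zip-consecutive y r v)

<ᵇ-true : ∀ {m n} → m < n → (m <ᵇ n) ≡ true
<ᵇ-true m<n = Equivalence.to T-≡ (<⇒<ᵇ m<n)

<ᵇ-false : ∀ {m n} → n ≤ m → (m <ᵇ n) ≡ false
<ᵇ-false {m} {n} n≤m with m <ᵇ n in eq
... | false = refl
... | true = ⊥-elim (<⇒≱ (<ᵇ⇒< m n (Equivalence.from T-≡ eq)) n≤m)

-- Edges as unordered pairs

module _ {n : ℕ} where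

  SameEdge : Fin n × Fin n → Fin n × Fin n → Set
  SameEdge (x , y) (a , b) = (x ≡ a × y ≡ b) ⊎ (x ≡ b × y ≡ a)

  SameEdge? : ∀ p q → Dec (SameEdge p q)
  SameEdge? (x , y) (a , b) = ((x ≟F a) ×-dec (y ≟F b)) ⊎-dec ((x ≟F b) ×-dec (y ≟F a))

  _≟P_ : ∀ (p q : Fin n × Fin n) → Dec (p ≡ q)
  _≟P_ = ≡-dec _≟F_ _≟F_

  _∈ₚ?_ : ∀ (p : Fin n × Fin n) ps → Dec (p ∈ ps)
  _∈ₚ?_ = DecMembership._∈?_ _≟P_

  SameEdge-refl : ∀ {p} → SameEdge p p
  SameEdge-refl = inj₁ (refl , refl)

  SameEdge-flipˡ : ∀ {x y p} → SameEdge (x , y) p → SameEdge (y , x) p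
  SameEdge-flipˡ (inj₁ (refl , refl)) = inj₂ (refl , refl)
  SameEdge-flipˡ (inj₂ (refl , refl)) = inj₁ (refl , refl)

  SameEdge-sym : ∀ {p q} → SameEdge p q → SameEdge q p
  SameEdge-sym (inj₁ (refl , refl)) = inj₁ (refl , refl)
  SameEdge-sym (inj₂ (refl , refl)) = inj₂ (refl , refl)

  SameEdge-trans : ∀ {p q r} → SameEdge p q → SameEdge q r → SameEdge p r
  SameEdge-trans (inj₁ (refl , refl)) q~r = q~r
  SameEdge-trans (inj₂ (refl , refl)) q~r = SameEdge-flipˡ q~r

  SameEdge-flipʳ : ∀ {p a b} → SameEdge p (a , b) → SameEdge p (b , a)
  SameEdge-flipʳ (inj₁ (refl , refl)) = inj₂ (refl , refl)
  SameEdge-flipʳ (inj₂ (refl , refl)) = inj₁ (refl , refl)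

  _∈ₑ_ : Fin n → Fin n × Fin n → Set
  x ∈ₑ (u , v) = x ≡ u ⊎ x ≡ v

  ∈ₑ-resp : ∀ {x p q} → SameEdge p q → x ∈ₑ q → x ∈ₑ p
  ∈ₑ-resp (inj₁ (refl , refl)) x∈q = x∈q
  ∈ₑ-resp (inj₂ (refl , refl)) (inj₁ x≡u) = inj₂ x≡u
  ∈ₑ-resp (inj₂ (refl , refl)) (inj₂ x≡v) = inj₁ x≡v

  -- The form (i , j), toℕ i < toℕ j, in which `edges` lists the edge {a, b}.
  sortPair : Fin n → Fin n → Fin n × Fin n
  sortPair a b = if toℕ a <ᵇ toℕ b then (a , b) else (b , a)

  sortPair-SameEdge : ∀ a b → SameEdge (sortPair a b) (a , b)
  sortPair-SameEdge a b with toℕ a <ᵇ toℕ b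
  ... | true = inj₁ (refl , refl)
  ... | false = inj₂ (refl , refl)

  sortPair-< : ∀ {a b} → toℕ a < toℕ b → sortPair a b ≡ (a , b)
  sortPair-< a<b rewrite <ᵇ-true a<b = refl

  sortPair-> : ∀ {a b} → toℕ b < toℕ a → sortPair a b ≡ (b , a)
  sortPair-> b<a rewrite <ᵇ-false (<⇒≤ b<a) = refl

  sortPair-comm : ∀ a b → sortPair a b ≡ sortPair b a
  sortPair-comm a b with <-cmp (toℕ a) (toℕ b)
  ... | tri< a<b _ _ = trans (sortPair-< a<b) (sym (sortPair-> a<b))
  ... | tri≈ _ a≡b _ rewrite toℕ-injective a≡b = refl
  ... | tri> _ _ b<a = trans (sortPair-> b<a) (sym (sortPair-< b<a))

  sortPair-cong : ∀ {a b c d} → SameEdge (a , b) (c , d) → sortPair a b ≡ sortPair c d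
  sortPair-cong (inj₁ (refl , refl)) = refl
  sortPair-cong (inj₂ (refl , refl)) = sortPair-comm _ _

  sortPair-injective : ∀ {a b c d} → sortPair a b ≡ sortPair c d → SameEdge (a , b) (c , d)
  sortPair-injective {a} {b} {c} {d} eq = SameEdge-trans (SameEdge-sym (sortPair-SameEdge a b))
                                                         (subst (λ p → SameEdge p (c , d)) (sym eq) (sortPair-SameEdge c d))

-- AdjMinus G a b is definitionally Without (Adj G) (a , b).
Without : ∀ {n} → (Fin n → Fin n → Set) → Fin n × Fin n → Fin n → Fin n → Set
Without R e x y = R x y × ¬ SameEdge (x , y) e

Without-sym : ∀ {n} {R : Fin n → Fin n → Set} {e x y} → (∀ {x y} → R x y → R y x) →
              Without R e x y → Without R e y x
Without-sym R-sym (x~y , xy≁e) = R-sym x~y , xy≁e ∘ SameEdge-flipˡ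

size : ∀ {n} → Graph n → ℕ
size G = length (edges G)

module _ {n : ℕ} (G : Graph n) where

  Adj-sym : ∀ {a b} → Adj G a b → Adj G b a
  Adj-sym {a} {b} = trans (Graph.sym G b a)

  Adj-irrefl : ∀ {a b} → Adj G a b → a ≢ b
  Adj-irrefl {a} a~a refl with trans (sym (irrefl G a)) a~a
  ... | ()

  AdjMinus-sym : ∀ {a b x y} → AdjMinus G a b x y → AdjMinus G a b y x
  AdjMinus-sym = Without-sym Adj-sym

  Adj-resp-SameEdge : ∀ {a b x y} → SameEdge (a , b) (x , y) → Adj G a b → Adj G x y
  Adj-resp-SameEdge (inj₁ (refl , refl)) a~b = a~b
  Adj-resp-SameEdge (inj₂ (refl , refl)) a~b = Adj-sym a~b

  private
    row : Fin n → List (Fin n × Fin n)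
    row i = map (i ,_) (filterᵇ (λ j → (toℕ i <ᵇ toℕ j) ∧ adj G i j) (allFin n))

  ∈-edges⁺ : ∀ {i j} → toℕ i < toℕ j → Adj G i j → (i , j) ∈ edges G
  ∈-edges⁺ {i} {j} i<j i~j = ∈-concatMap⁺ row (lose (∈-allFin i)
    (∈-map⁺ (i ,_) (∈-filter⁺ (λ j → T? ((toℕ i <ᵇ toℕ j) ∧ adj G i j)) (∈-allFin j)
      (Equivalence.from T-∧ (<⇒<ᵇ i<j , Equivalence.from T-≡ i~j)))))

  ∈-edges⁻ : ∀ {i j} → (i , j) ∈ edges G → toℕ i < toℕ j × Adj G i j
  ∈-edges⁻ e∈ with satisfied (∈-concatMap⁻ row {xs = allFin n} e∈)
  ... | i , e∈row with ∈-map⁻ (i ,_) e∈row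
  ... | j , j∈ , refl with ∈-filter⁻ (λ j → T? ((toℕ i <ᵇ toℕ j) ∧ adj G i j)) {xs = allFin n} j∈
  ... | _ , t with Equivalence.to T-∧ t
  ... | i<ᵇj , i~j = <ᵇ⇒< _ _ i<ᵇj , Equivalence.to T-≡ i~j

  Unique-edges : Unique (edges G)
  Unique-edges = rows (allFin n) (allFin⁺ n)
    where
    rows : ∀ is → Unique is → Unique (concatMap row is)
    rows [] _ = []
    rows (i ∷ is) (i∉ ∷ u) = ++⁺ (map⁺ (cong proj₂) (filter⁺ _ (allFin⁺ n))) (rows is u) disjoint
      where
      disjoint : Disjoint (row i) (concatMap row is)
      disjoint (e∈row , e∈rows) with ∈-map⁻ (i ,_) e∈row | find (∈-concatMap⁻ row {xs = is} e∈rows)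
      ... | _ , _ , refl | i′ , i′∈is , e∈row′ with ∈-map⁻ (i′ ,_) e∈row′
      ... | _ , _ , refl = lookup i∉ i′∈is refl

  sortPair-∈-edges : ∀ {a b} → Adj G a b → sortPair a b ∈ edges G
  sortPair-∈-edges {a} {b} a~b with <-cmp (toℕ a) (toℕ b)
  ... | tri< a<b _ _ = subst (_∈ edges G) (sym (sortPair-< a<b)) (∈-edges⁺ a<b a~b)
  ... | tri≈ _ a≡b _ = ⊥-elim (Adj-irrefl a~b (toℕ-injective a≡b))
  ... | tri> _ _ b<a = subst (_∈ edges G) (sym (sortPair-> b<a)) (∈-edges⁺ b<a (Adj-sym a~b))

deg≤length : ∀ {n} (G : Graph n) v xs → (∀ {j} → Adj G v j → toℕ j ∈ xs) → deg G v ≤ length xs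
deg≤length {n} G v xs nbrs⊆xs = subst (_≤ length xs) (length-map toℕ (filterᵇ (adj G v) (allFin n)))
  (Unique-length-≤ (map⁺ toℕ-injective (filter⁺ (T? ∘ adj G v) (allFin⁺ n))) nbrs⊆)
  where
  nbrs⊆ : ∀ {x} → x ∈ map toℕ (filterᵇ (adj G v) (allFin n)) → x ∈ xs
  nbrs⊆ x∈ with ∈-map⁻ toℕ x∈
  ... | j , j∈ , refl = nbrs⊆xs (Equivalence.to T-≡ (proj₂ (∈-filter⁻ (T? ∘ adj G v) {xs = allFin n} j∈)))

-- Walks

module _ {n : ℕ} where

  private
    Rel = Fin n → Fin n → Set

  Reach-map : ∀ {R S : Rel} → (∀ {a b} → R a b → S a b) → ∀ {u v} → Reach R u v → Reach S u v
  Reach-map f here = here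
  Reach-map f (step r w) = step (f r) (Reach-map f w)

  Reach-++ : ∀ {R : Rel} {u v w} → Reach R u v → Reach R v w → Reach R u w
  Reach-++ here q = q
  Reach-++ (step r p) q = step r (Reach-++ p q)

  Reach-bind : ∀ {R S : Rel} → (∀ {a b} → R a b → Reach S a b) → ∀ {u v} → Reach R u v → Reach S u v
  Reach-bind f here = here
  Reach-bind f (step r w) = Reach-++ (f r) (Reach-bind f w)

  Reach-reverse : ∀ {R : Rel} {u v} → Reach R u v → Reach (flip R) v u
  Reach-reverse here = here
  Reach-reverse (step r w) = Reach-++ (Reach-reverse w) (step r here)

  Reach-sym : ∀ {R : Rel} → (∀ {a b} → R a b → R b a) → ∀ {u v} → Reach R u v → Reach R v u
  Reach-sym R-sym = Reach-map R-sym ∘ Reach-reverse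

  Reach-visits-or-avoids : ∀ {R : Rel} x {s t} → Reach R s t →
    Reach R s x ⊎ (Reach (λ a b → R a b × a ≢ x × b ≢ x) s t × s ≢ x)
  Reach-visits-or-avoids x {s} walk with s ≟F x | walk
  ... | yes refl | _ = inj₁ here
  ... | no s≢x | here = inj₂ (here , s≢x)
  ... | no s≢x | step r walk′ with Reach-visits-or-avoids x walk′
  ...   | inj₁ to-x = inj₁ (step r to-x)
  ...   | inj₂ (avoiding , v≢x) = inj₂ (step (r , s≢x , v≢x) avoiding , s≢x)

  Without-detour : ∀ {R : Rel} → (∀ {x y} → R x y → R y x) →
    ∀ {a b} → Reach (Without R (a , b)) a b → ∀ {u v} → Reach R u v → Reach (Without R (a , b)) u v
  Without-detour {R = R} R-sym {a} {b} detour = Reach-bind replace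
    where
    replace : ∀ {x y} → R x y → Reach (Without R (a , b)) x y
    replace {x} {y} x~y with SameEdge? (x , y) (a , b)
    ... | no xy≁ab = step (x~y , xy≁ab) here
    ... | yes (inj₁ (refl , refl)) = detour
    ... | yes (inj₂ (refl , refl)) = Reach-sym (Without-sym R-sym) detour

  Reach-first-end : ∀ {R : Rel} {a b x} →
                    Reach R x a → Reach (Without R (a , b)) x a ⊎ Reach (Without R (a , b)) x b
  Reach-first-end here = inj₁ here
  Reach-first-end {a = a} {b} {x} (step {v = w} x~w walk) with SameEdge? (x , w) (a , b)
  ... | yes (inj₁ (refl , _)) = inj₁ here
  ... | yes (inj₂ (refl , _)) = inj₂ here
  ... | no xw≁ab with Reach-first-end walk
  ...   | inj₁ to-a = inj₁ (step (x~w , xw≁ab) to-a)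
  ...   | inj₂ to-b = inj₂ (step (x~w , xw≁ab) to-b)

-- Cycles

module _ {n : ℕ} where

  cycPairs-consecutive : ∀ (v : Fin n) vs → cycPairs (v ∷ vs) ≡ consecutive (v ∷ vs ++ [ v ])
  cycPairs-consecutive v vs = zip-consecutive v vs v

  cycPairs-∷-∷ʳ : ∀ (x : Fin n) xs → cycPairs (x ∷ xs) ≡ consecutive (x ∷ xs) ++ [ (lastOr x xs , x) ]
  cycPairs-∷-∷ʳ x xs = trans (cycPairs-consecutive x xs) (consecutive-∷ʳ x xs x)

  consecutive⊆cycPairs : ∀ (xs : List (Fin n)) → consecutive xs ⊆ cycPairs xs
  consecutive⊆cycPairs (x ∷ xs) p∈ = subst (_ ∈_) (sym (cycPairs-∷-∷ʳ x xs)) (∈-++⁺ˡ p∈)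

  cycPairs-rotate₁ : ∀ (x : Fin n) xs → cycPairs (x ∷ xs) ⊆ cycPairs (xs ++ [ x ])
  cycPairs-rotate₁ x [] p∈ = p∈
  cycPairs-rotate₁ x (y ∷ ys) {p} p∈ with subst (p ∈_) (cycPairs-consecutive x (y ∷ ys)) p∈
  ... | here refl = subst (p ∈_) (sym rotated) (∈-++⁺ʳ _ (here refl))
    where
    rotated : cycPairs (y ∷ ys ++ [ x ]) ≡ consecutive (y ∷ ys ++ [ x ]) ++ [ (x , y) ]
    rotated = trans (cycPairs-∷-∷ʳ y (ys ++ [ x ]))
                    (cong (λ l → consecutive (y ∷ ys ++ [ x ]) ++ [ (l , y) ]) (lastOr-∷ʳ y ys x))
  ... | there p∈′ = consecutive⊆cycPairs (y ∷ ys ++ [ x ]) p∈′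

  cycPairs-rotate : ∀ (xs ys : List (Fin n)) → cycPairs (xs ++ ys) ⊆ cycPairs (ys ++ xs)
  cycPairs-rotate [] ys = subst (λ l → cycPairs ys ⊆ cycPairs l) (sym (++-identityʳ ys)) (λ p∈ → p∈)
  cycPairs-rotate (x ∷ xs) ys {p} p∈ = subst (λ l → p ∈ cycPairs l) (++-assoc ys [ x ] xs)
    (cycPairs-rotate xs (ys ++ [ x ])
      (subst (λ l → p ∈ cycPairs l) (++-assoc xs ys [ x ]) (cycPairs-rotate₁ x (xs ++ ys) p∈)))

  length-cycPairs : ∀ (C : List (Fin n)) → length (cycPairs C) ≡ length C
  length-cycPairs [] = refl
  length-cycPairs (v ∷ vs) = trans (cong length (cycPairs-consecutive v vs))
    (trans (length-consecutive v (vs ++ [ v ])) (trans (length-++ vs) (+-comm (length vs) 1)))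

  CycEdge? : ∀ (D : List (Fin n)) a b → Dec (CycEdge D a b)
  CycEdge? D a b = (a , b) ∈ₚ? cycPairs D ⊎-dec (b , a) ∈ₚ? cycPairs D

  -- The cycle D read around from b to a, when (a , b) is one of its edges.
  record Rotation (D : List (Fin n)) (b a : Fin n) : Set where
    field
      middle : List (Fin n)
      unique : Unique (b ∷ middle ++ [ a ])
      length≡ : length (b ∷ middle ++ [ a ]) ≡ length D
      links⊆ : consecutive (b ∷ middle ++ [ a ]) ⊆ cycPairs D

  rotation : ∀ {D a b} → Unique D → 3 ≤ length D → (a , b) ∈ cycPairs D → Rotation D b a
  rotation {h ∷ t} {a} {b} uD 3≤ ab∈
    with ∈-++⁻ (consecutive (h ∷ t)) (subst ((a , b) ∈_) (cycPairs-∷-∷ʳ h t) ab∈)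
  ... | inj₂ (here refl) = closing t uD 3≤
    where
    closing : ∀ t → Unique (h ∷ t) → 3 ≤ suc (length t) → Rotation (h ∷ t) h (lastOr h t)
    closing t u 3≤ with initLast t
    closing _ u (s≤s ()) | []
    closing _ u 3≤ | M ∷ʳ′ a′ = subst (Rotation (h ∷ M ++ [ a′ ]) h) (sym (lastOr-∷ʳ h M a′))
      (record { middle = M ; unique = u ; length≡ = refl ; links⊆ = consecutive⊆cycPairs _ })
  ... | inj₁ ab∈′ with ∈-consecutive⁻ (h ∷ t) ab∈′
  ... | P , S , eq = record
    { middle = S ++ P
    ; unique = subst Unique (sym rotated) (Unique-++-comm (P ++ [ a ]) (b ∷ S) (subst Unique split uD))
    ; length≡ = trans (cong length rotated) (trans (length-++-comm (b ∷ S) (P ++ [ a ])) (cong length (sym split)))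
    ; links⊆ = λ {p} p∈ → subst (λ l → p ∈ cycPairs l) (sym split)
        (cycPairs-rotate (b ∷ S) (P ++ [ a ]) (subst (λ l → p ∈ cycPairs l) rotated (consecutive⊆cycPairs _ p∈)))
    }
    where
    split : h ∷ t ≡ (P ++ [ a ]) ++ b ∷ S
    split = trans eq (sym (++-assoc P [ a ] (b ∷ S)))
    rotated : b ∷ (S ++ P) ++ [ a ] ≡ (b ∷ S) ++ P ++ [ a ]
    rotated = cong (b ∷_) (++-assoc S P [ a ])

module _ {n : ℕ} (G : Graph n) where

  CycEdge-sym : ∀ {D : List (Fin n)} {x y} → CycEdge D x y → CycEdge D y x
  CycEdge-sym (inj₁ xy∈) = inj₂ xy∈
  CycEdge-sym (inj₂ yx∈) = inj₁ yx∈

  CycEdge-resp : ∀ {D : List (Fin n)} {x y a b} → SameEdge (x , y) (a , b) → CycEdge D x y → CycEdge D a b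
  CycEdge-resp (inj₁ (refl , refl)) xy∈D = xy∈D
  CycEdge-resp {D} (inj₂ (refl , refl)) xy∈D = CycEdge-sym {D} xy∈D

  CycEdge⇒Adj : ∀ {D a b} → IsCycle G D → CycEdge D a b → Adj G a b
  CycEdge⇒Adj (_ , _ , adjacent) (inj₁ ab∈) = lookup adjacent ab∈
  CycEdge⇒Adj (_ , _ , adjacent) (inj₂ ba∈) = Adj-sym G (lookup adjacent ba∈)

  IsCycle⇒∃cycPair : ∀ {C} → IsCycle G C → ∃ λ a → ∃ λ b → (a , b) ∈ cycPairs C
  IsCycle⇒∃cycPair {a ∷ b ∷ _} _ = a , b , here refl
  IsCycle⇒∃cycPair {_ ∷ []} (s≤s () , _)

  CycAdj : List (Fin n) → Fin n → Fin n → Set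
  CycAdj D x y = Adj G x y × CycEdge D x y

  CycAdj-sym : ∀ {D x y} → CycAdj D x y → CycAdj D y x
  CycAdj-sym {D} (x~y , xy∈D) = Adj-sym G x~y , CycEdge-sym {D} xy∈D

  cycPair⇒CycAdj : ∀ {D x y} → IsCycle G D → (x , y) ∈ cycPairs D → CycAdj D x y
  cycPair⇒CycAdj cyc xy∈ = CycEdge⇒Adj cyc (inj₁ xy∈) , inj₁ xy∈

  private
    Off : Fin n → Fin n → Fin n → Set
    Off a b z = z ≢ a × z ≢ b

    off-step : ∀ {a b x y} → Off a b x → ¬ SameEdge (x , y) (a , b)
    off-step (x≢a , _) (inj₁ (x≡a , _)) = x≢a x≡a
    off-step (_ , x≢b) (inj₂ (x≡b , _)) = x≢b x≡b

    walk-to-end : ∀ {D a b} → IsCycle G D → ∀ x M → Off a b x → All (Off a b) M →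
                  consecutive (x ∷ M ++ [ a ]) ⊆ cycPairs D → Reach (Without (CycAdj D) (a , b)) x a
    walk-to-end cyc x [] x-off [] links = step (cycPair⇒CycAdj cyc (links (here refl)) , off-step x-off) here
    walk-to-end cyc x (m ∷ M) x-off (m-off ∷ M-off) links =
      step (cycPair⇒CycAdj cyc (links (here refl)) , off-step x-off) (walk-to-end cyc m M m-off M-off (links ∘ there))

  cycle-walk : ∀ {D a b} → IsCycle G D → (a , b) ∈ cycPairs D → Reach (Without (CycAdj D) (a , b)) b a
  cycle-walk {D} {a} {b} cyc@(3≤ , uD , _) ab∈ with rotation uD 3≤ ab∈
  ... | record { middle = [] ; length≡ = length≡ } = ⊥-elim (<⇒≱ (subst (3 ≤_) (sym length≡) 3≤) (s≤s (s≤s z≤n)))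
  ... | record { middle = m ∷ M ; unique = b∉ ∷ m∉ ∷ uM ; links⊆ = links } =
    step (cycPair⇒CycAdj cyc (links (here refl)) , first-step) (walk-to-end cyc m M (m≢a , m≢b) M-off (links ∘ there))
    where
    m≢b : m ≢ b
    m≢b m≡b = lookup b∉ (here refl) (sym m≡b)
    m≢a : m ≢ a
    m≢a m≡a = lookup m∉ (∈-++⁺ʳ M (here refl)) m≡a
    first-step : ¬ SameEdge (b , m) (a , b)
    first-step (inj₁ (_ , m≡b)) = m≢b m≡b
    first-step (inj₂ (_ , m≡a)) = m≢a m≡a
    M-off : All (Off a b) M
    M-off = tabulate λ z∈ →
      (λ z≡a → proj₂ (proj₂ (Unique-++⁻ M uM)) (z∈ , subst (_∈ [ a ]) (sym z≡a) (here refl))) ,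
      (λ z≡b → lookup b∉ (there (∈-++⁺ˡ z∈)) (sym z≡b))

  cycle-edge-detour : ∀ {D a b} → IsCycle G D → CycEdge D a b → Reach (Without (CycAdj D) (a , b)) a b
  cycle-edge-detour {D} cyc (inj₁ ab∈) = Reach-sym (Without-sym (CycAdj-sym {D})) (cycle-walk cyc ab∈)
  cycle-edge-detour cyc (inj₂ ba∈) = Reach-map (λ (xy∈D , xy≁ba) → xy∈D , xy≁ba ∘ SameEdge-flipʳ) (cycle-walk cyc ba∈)

  cycle-edge-nonbridge : ∀ {D a b} → IsCycle G D → CycEdge D a b → Reach (AdjMinus G a b) a b
  cycle-edge-nonbridge cyc ab∈D = Reach-map (λ ((x~y , _) , xy≁ab) → x~y , xy≁ab) (cycle-edge-detour cyc ab∈D)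

  walk-along : ∀ (h : Fin n) L {x} → x ∈ h ∷ L → Reach (λ u v → (u , v) ∈ consecutive (h ∷ L)) h x
  walk-along h L (here refl) = here
  walk-along h (y ∷ L) (there x∈) = step (here refl) (Reach-map there (walk-along y L x∈))

  cycle-arc : ∀ {h t x} → IsCycle G (h ∷ t) → x ∈ h ∷ t → Reach (CycAdj (h ∷ t)) h x
  cycle-arc {h} {t} cyc x∈ = Reach-map (cycPair⇒CycAdj cyc ∘ consecutive⊆cycPairs (h ∷ t)) (walk-along h t x∈)

module _ {n : ℕ} where

  record Path (Q : Fin n → Fin n → Set) (u v : Fin n) : Set where
    field
      rest : List (Fin n)
      unique : Unique (u ∷ rest)
      links : ∀ {p} → p ∈ consecutive (u ∷ rest) → Q (proj₁ p) (proj₂ p)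
      ends : lastOr u rest ≡ v

  Reach⇒Path : ∀ {Q u v} → Reach Q u v → Path Q u v
  Reach⇒Path here = record { rest = [] ; unique = [] ∷ [] ; links = λ () ; ends = refl }
  Reach⇒Path {Q} {u} (step {v = w} q walk) with Reach⇒Path walk
  ... | record { rest = xs ; unique = uxs ; links = links ; ends = ends } with u ∈ᵥ? (w ∷ xs)
  ... | no u∉ = record { rest = w ∷ xs ; unique = ∉⇒Unique-∷ u∉ uxs ; links = links′ ; ends = ends }
    where
    links′ : ∀ {p} → p ∈ consecutive (u ∷ w ∷ xs) → Q (proj₁ p) (proj₂ p)
    links′ (here refl) = q
    links′ (there p∈) = links p∈
  ... | yes u∈ with ∈-∃++ u∈
  ... | ys , zs , eq = record
    { rest = zs
    ; unique = proj₁ (proj₂ (Unique-++⁻ ys (subst Unique eq uxs)))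
    ; links = λ {p} p∈ → links (subst (p ∈_) (cong consecutive (sym eq)) (consecutive-++ʳ ys (u ∷ zs) p∈))
    ; ends = trans (sym (lastOr-split ys eq)) ends
    }
    where
    lastOr-split : ∀ ys {x xs zs} → x ∷ xs ≡ ys ++ u ∷ zs → lastOr x xs ≡ lastOr u zs
    lastOr-split [] refl = refl
    lastOr-split (y ∷ ys) {zs = zs} refl = lastOr-++-∷ ys y u zs

  non-bridge⇒cycle : ∀ (G : Graph n) {u v} → Adj G u v → Reach (AdjMinus G u v) u v → ∃ (IsCycle G)
  non-bridge⇒cycle G {u} {v} u~v walk with Reach⇒Path walk
  ... | record { rest = [] ; ends = refl } = ⊥-elim (Adj-irrefl G u~v refl)
  ... | record { rest = y ∷ [] ; links = links ; ends = refl } = ⊥-elim (proj₂ (links (here refl)) SameEdge-refl)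
  ... | record { rest = y ∷ z ∷ xs ; unique = uC ; links = links ; ends = ends } =
    u ∷ y ∷ z ∷ xs , s≤s (s≤s (s≤s z≤n)) , uC , tabulate closed
    where
    closed : ∀ {p} → p ∈ cycPairs (u ∷ y ∷ z ∷ xs) → Adj G (proj₁ p) (proj₂ p)
    closed {p} p∈ with ∈-++⁻ (consecutive (u ∷ y ∷ z ∷ xs)) (subst (p ∈_) (cycPairs-∷-∷ʳ u (y ∷ z ∷ xs)) p∈)
    ... | inj₁ p∈path = proj₁ (links p∈path)
    ... | inj₂ (here refl) = subst (λ x → Adj G x u) (sym ends) (Adj-sym G u~v)

-- Spanning trees and edge counts

module Spanning {n : ℕ} (R : Fin n → Fin n → Set) (r : Fin n) (reach : ∀ y → Reach R r y) where

  REdge : Fin n × Fin n → Set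
  REdge p = ∃ λ a → ∃ λ b → R a b × sortPair a b ≡ p

  TreeAdj : List (Fin n × Fin n) → Fin n → Fin n → Set
  TreeAdj P a b = sortPair a b ∈ P

  record Subtree (t : ℕ) : Set where
    field
      vertices : List (Fin n)
      tree-edges : List (Fin n × Fin n)
      vertices-unique : Unique vertices
      vertices-length : length vertices ≡ suc t
      edges-unique : Unique tree-edges
      edges-length : length tree-edges ≡ t
      endpoints : All (λ p → proj₁ p ∈ vertices × proj₂ p ∈ vertices) tree-edges
      edges-R : All REdge tree-edges
      root : r ∈ vertices
      spans : All (Reach (TreeAdj tree-edges) r) vertices

  crossing : ∀ S {x y} → Reach R x y → x ∈ S → y ∉ S → ∃ λ a → ∃ λ b → R a b × a ∈ S × b ∉ S
  crossing S here x∈ y∉ = ⊥-elim (y∉ x∈)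
  crossing S {x} (step {v = v} x~v walk) x∈ y∉ with v ∈ᵥ? S
  ... | yes v∈ = crossing S walk v∈ y∉
  ... | no v∉ = x , v , x~v , x∈ , v∉

  extend : ∀ {t} → Subtree t → suc t < n → Subtree (suc t)
  extend {t} T t<n with length<⇒∃∉ (Subtree.vertices T) (subst (_< n) (sym (Subtree.vertices-length T)) t<n)
  ... | y , y∉ with crossing (Subtree.vertices T) (reach y) (Subtree.root T) y∉
  ... | a , b , a~b , a∈ , b∉ = record
    { vertices = b ∷ vertices
    ; tree-edges = sortPair a b ∷ tree-edges
    ; vertices-unique = ∉⇒Unique-∷ b∉ vertices-unique
    ; vertices-length = cong suc vertices-length
    ; edges-unique = ∉⇒Unique-∷ new∉ edges-unique
    ; edges-length = cong suc edges-length
    ; endpoints = new-endpoints ∷ All-map (λ (p₁∈ , p₂∈) → there p₁∈ , there p₂∈) endpoints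
    ; edges-R = (a , b , a~b , refl) ∷ edges-R
    ; root = there root
    ; spans = Reach-++ (Reach-map there (lookup spans a∈)) (step (here refl) here)
            ∷ All-map (Reach-map there) spans
    }
    where
    open Subtree T
    new-endpoints : proj₁ (sortPair a b) ∈ b ∷ vertices × proj₂ (sortPair a b) ∈ b ∷ vertices
    new-endpoints with sortPair a b | sortPair-SameEdge a b
    ... | _ | inj₁ (refl , refl) = there a∈ , here refl
    ... | _ | inj₂ (refl , refl) = here refl , there a∈
    new∉ : sortPair a b ∉ tree-edges
    new∉ ab∈ with lookup endpoints ab∈ | sortPair-SameEdge a b
    ... | _ , p₂∈ | inj₁ (_ , p₂≡b) = b∉ (subst (_∈ vertices) p₂≡b p₂∈)
    ... | p₁∈ , _ | inj₂ (p₁≡b , _) = b∉ (subst (_∈ vertices) p₁≡b p₁∈)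

  grow : ∀ t → t < n → Subtree t
  grow zero _ = record
    { vertices = [ r ] ; tree-edges = [] ; vertices-unique = [] ∷ [] ; vertices-length = refl
    ; edges-unique = [] ; edges-length = refl ; endpoints = [] ; edges-R = [] ; root = here refl ; spans = here ∷ [] }
  grow (suc t) t<n = extend (grow t (<-trans (n<1+n t) t<n)) t<n

  spanning-tree : ∃ λ P → Unique P × suc (length P) ≡ n × All REdge P × (∀ y → Reach (TreeAdj P) r y)
  spanning-tree = tree-edges , edges-unique , trans (cong suc edges-length) n≡ , edges-R , spans-all
    where
    n≡ : suc (n ∸ 1) ≡ n
    n≡ = m+[n∸m]≡n (≤-trans (s≤s z≤n) (toℕ<n r))
    open Subtree (grow (n ∸ 1) (subst (n ∸ 1 <_) n≡ (n<1+n (n ∸ 1))))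
    spans-all : ∀ y → Reach (TreeAdj tree-edges) r y
    spans-all y with y ∈ᵥ? vertices
    ... | yes y∈ = lookup spans y∈
    ... | no y∉ = ⊥-elim (1+n≰n (subst₂ _≤_ (cong suc (trans vertices-length n≡)) (length-allFin n)
                    (Unique-length-≤ (∉⇒Unique-∷ y∉ vertices-unique) λ {z} _ → ∈-allFin z)))

module _ {n : ℕ} (G : Graph n) where

  spanning-bound : ∀ {R} → (∀ {a b} → R a b → Adj G a b) → ∀ r → (∀ y → Reach R r y) →
                   ∀ X → Unique X → X ⊆ edges G → (∀ {a b} → R a b → sortPair a b ∉ X) →
                   n + length X ≤ suc (size G)
  spanning-bound {R} R⇒Adj r reach X uX X⊆E R∉X with Spanning.spanning-tree R r reach
  ... | P , uP , |P|≡ , P-R , _ = subst (_≤ suc (size G)) (cong (_+ length X) |P|≡)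
        (s≤s (subst (_≤ size G) (length-++ P) (Unique-length-≤ (++⁺ uP uX disjoint) P++X⊆E)))
    where
    disjoint : Disjoint P X
    disjoint (p∈P , p∈X) with lookup P-R p∈P
    ... | _ , _ , a~b , refl = R∉X a~b p∈X
    P++X⊆E : P ++ X ⊆ edges G
    P++X⊆E p∈ with ∈-++⁻ P p∈
    ... | inj₁ p∈P with lookup P-R p∈P
    ...   | _ , _ , a~b , refl = sortPair-∈-edges G (R⇒Adj a~b)
    P++X⊆E p∈ | inj₂ p∈X = X⊆E p∈X

  module _ (connected : Connected G) where

    non-bridge⇒order≤size : ∀ {a b} → Adj G a b → Reach (AdjMinus G a b) a b → n ≤ size G
    non-bridge⇒order≤size {a} {b} a~b detour =
      ≤-pred (subst (_≤ suc (size G)) (+-comm n 1)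
        (spanning-bound proj₁ a (λ y → Without-detour (Adj-sym G) detour (connected a y))
          [ sortPair a b ] ([] ∷ []) (λ { (here refl) → sortPair-∈-edges G a~b })
          (λ { (_ , xy≁ab) (here eq) → xy≁ab (sortPair-injective eq) })))

    -- A spanning tree of Γ − ab − cd has n − 1 edges, none of them ab or cd.
    two-non-bridges⇒order<size : ∀ {a b c d} → Adj G a b → Adj G c d → ¬ SameEdge (a , b) (c , d) →
      Reach (AdjMinus G a b) a b → Reach (Without (AdjMinus G a b) (c , d)) c d → n < size G
    two-non-bridges⇒order<size {a} {b} {c} {d} a~b c~d ab≁cd detour₁ detour₂ =
      ≤-pred (subst (_≤ suc (size G)) (+-comm n 2)
        (spanning-bound (proj₁ ∘ proj₁) a
          (λ y → Without-detour (AdjMinus-sym G) detour₂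
                   (Without-detour (Adj-sym G) detour₁ (connected a y)))
          (sortPair a b ∷ sortPair c d ∷ []) (((ab≁cd ∘ sortPair-injective) ∷ []) ∷ [] ∷ [])
          (λ { (here refl) → sortPair-∈-edges G a~b ; (there (here refl)) → sortPair-∈-edges G c~d })
          (λ { ((_ , xy≁ab) , _) (here eq) → xy≁ab (sortPair-injective eq)
             ; (_ , xy≁cd) (there (here eq)) → xy≁cd (sortPair-injective eq) })))

order≤1+size : ∀ {n} (G : Graph n) → Connected G → n ≤ suc (size G)
order≤1+size {zero} G _ = z≤n
order≤1+size {suc n} G connected = subst (_≤ suc (size G)) (+-identityʳ (suc n))
  (spanning-bound G (λ a~b → a~b) Fin.zero (connected Fin.zero) [] [] (λ ()) (λ _ ()))

-- Bridges and cycles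

module _ {n : ℕ} (G : Graph n) (connected : Connected G) where

  -- An edge outside a spanning tree closes a cycle with the tree path between its ends.
  order≤size⇒cycle : Fin n → n ≤ size G → ∃ (IsCycle G)
  order≤size⇒cycle r n≤m with Spanning.spanning-tree (Adj G) r (connected r)
  ... | P , uP , |P|≡ , P-edges , spans with all? (_∈ₚ? P) (edges G)
  ... | yes E⊆P = ⊥-elim (1+n≰n (≤-trans (subst (_≤ size G) (sym |P|≡) n≤m)
                                          (Unique-length-≤ (Unique-edges G) (lookup E⊆P))))
  ... | no E⊈P with find (¬All⇒Any¬ (_∈ₚ? P) (edges G) E⊈P)
  ... | (u , v) , uv∈E , uv∉P with ∈-edges⁻ G uv∈E
  ... | u<v , u~v = non-bridge⇒cycle G u~v (Reach-map tree-step (Reach-++ (Reach-sym tree-sym (spans u)) (spans v)))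
    where
    tree-sym : ∀ {x y} → sortPair x y ∈ P → sortPair y x ∈ P
    tree-sym {x} {y} = subst (_∈ P) (sortPair-comm x y)
    tree-step : ∀ {x y} → sortPair x y ∈ P → AdjMinus G u v x y
    tree-step {x} {y} xy∈P with lookup P-edges xy∈P
    ... | a , b , a~b , eq = Adj-resp-SameEdge G (sortPair-injective eq) a~b ,
                             λ xy~uv → uv∉P (subst (_∈ P) (trans (sortPair-cong xy~uv) (sortPair-< u<v)) xy∈P)

  -- Otherwise Γ is a tree, all of whose n − 1 edges are bridges.
  few-bridges⇒order≤size : ∀ {k} → HasBridges G k → k < n ∸ 1 → n ≤ size G
  few-bridges⇒order≤size {k} (L , _ , |L|≡k , L-spec) k<n-1 with n ≤? size G
  ... | yes n≤m = n≤m
  ... | no n≰m = ⊥-elim (<⇒≱ k<n-1 (≤-trans (≤-reflexive (cong (_∸ 1) n≡1+m)) (subst (size G ≤_) |L|≡k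
                   (Unique-length-≤ (Unique-edges G) edges⊆L))))
    where
    n≡1+m : n ≡ suc (size G)
    n≡1+m = ≤-antisym (order≤1+size G connected) (≰⇒> n≰m)
    edges⊆L : edges G ⊆ L
    edges⊆L {u , v} uv∈E with ∈-edges⁻ G uv∈E
    ... | u<v , u~v = proj₂ (L-spec u v) (u<v , u~v , λ detour →
                        1+n≰n (subst (_≤ size G) n≡1+m (non-bridge⇒order≤size G connected u~v detour)))

  record Sides (h u v : Fin n) : Set where
    field
      far near : Fin n
      ends : SameEdge (far , near) (u , v)
      near-reachable : Reach (AdjMinus G u v) h near

  sides : ∀ h u v → Sides h u v
  sides h u v with Reach-first-end (connected h u)
  ... | inj₁ to-u = record { far = v ; near = u ; ends = inj₂ (refl , refl) ; near-reachable = to-u }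
  ... | inj₂ to-v = record { far = u ; near = v ; ends = inj₁ (refl , refl) ; near-reachable = to-v }

  -- The endpoint of uv that lies on the other side of uv from h when uv is a bridge.
  far-end : Fin n → Fin n × Fin n → Fin n
  far-end h (u , v) = Sides.far (sides h u v)

  far-end-unreachable : ∀ {h u v} → IsBridge G u v → ¬ Reach (AdjMinus G u v) h (far-end h (u , v))
  far-end-unreachable {h} {u} {v} (_ , ¬detour) to-far with sides h u v
  ... | record { ends = inj₁ (refl , refl) ; near-reachable = to-near } =
    ¬detour (Reach-++ (Reach-sym (AdjMinus-sym G) to-far) to-near)
  ... | record { ends = inj₂ (refl , refl) ; near-reachable = to-near } =
    ¬detour (Reach-++ (Reach-sym (AdjMinus-sym G) to-near) to-far)

  far-end-injective : ∀ {h u₁ v₁ u₂ v₂} → IsBridge G u₁ v₁ → IsBridge G u₂ v₂ →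
                      far-end h (u₁ , v₁) ≡ far-end h (u₂ , v₂) → SameEdge (u₁ , v₁) (u₂ , v₂)
  far-end-injective {h} {u₁} {v₁} {u₂} {v₂} br₁ br₂ same with SameEdge? (u₁ , v₁) (u₂ , v₂)
  ... | yes b₁~b₂ = b₁~b₂
  ... | no b₁≁b₂
    with sides h u₁ v₁ | sides h u₂ v₂ | far-end-unreachable {h} br₁ | far-end-unreachable {h} br₂ | same
  ... | record { far = x ; near = y₁ ; ends = ends₁ ; near-reachable = to-y₁ } | record { ends = ends₂ }
      | ¬to-x₁ | ¬to-x₂ | refl
    with Reach-visits-or-avoids x to-y₁
  ... | inj₁ to-x = ⊥-elim (¬to-x₁ to-x)
  ... | inj₂ (avoiding , _) = ⊥-elim (¬to-x₂ (Reach-++ (Reach-map off-b₂ avoiding) (step last-step here)))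
    where
    off-b₂ : ∀ {a c} → AdjMinus G u₁ v₁ a c × a ≢ x × c ≢ x → AdjMinus G u₂ v₂ a c
    off-b₂ ((a~c , _) , a≢x , c≢x) = a~c , λ ac~b₂ →
      case ∈ₑ-resp ac~b₂ (∈ₑ-resp (SameEdge-sym ends₂) (inj₁ refl)) of λ where
      (inj₁ x≡a) → a≢x (sym x≡a)
      (inj₂ x≡c) → c≢x (sym x≡c)
    y₁x~b₁ : SameEdge (y₁ , x) (u₁ , v₁)
    y₁x~b₁ = SameEdge-flipˡ ends₁
    last-step : AdjMinus G u₂ v₂ y₁ x
    last-step = Adj-resp-SameEdge G (SameEdge-sym y₁x~b₁) (proj₁ br₁) , b₁≁b₂ ∘ SameEdge-trans (SameEdge-sym y₁x~b₁)

  far-end∉cycle : ∀ {h t u v} → IsCycle G (h ∷ t) → IsBridge G u v → far-end h (u , v) ∉ h ∷ t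
  far-end∉cycle {h} {t} {u} {v} cyc br far∈C = far-end-unreachable br (Reach-map off-bridge (cycle-arc G cyc far∈C))
    where
    off-bridge : ∀ {a c} → CycAdj G (h ∷ t) a c → AdjMinus G u v a c
    off-bridge (a~c , ac∈C) = a~c , λ where
      (inj₁ (refl , refl)) → proj₂ br (cycle-edge-nonbridge G cyc ac∈C)
      (inj₂ (refl , refl)) → proj₂ br (cycle-edge-nonbridge G cyc (CycEdge-sym G {h ∷ t} ac∈C))

  cycle+bridges≤order : ∀ {C k} → IsCycle G C → HasBridges G k → length C + k ≤ n
  cycle+bridges≤order {h ∷ t} {k} cyc@(_ , uC , _) (L , uL , |L|≡k , L-spec) =
    subst₂ _≤_ (trans (length-++ (h ∷ t)) (cong (length (h ∷ t) +_) (trans (length-map (far-end h) L) |L|≡k)))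
               (length-allFin n)
      (Unique-length-≤ (++⁺ uC (Unique-map⁺-on far-injective uL) disjoint) λ {z} _ → ∈-allFin z)
    where
    far-injective : ∀ {b₁ b₂} → b₁ ∈ L → b₂ ∈ L → far-end h b₁ ≡ far-end h b₂ → b₁ ≡ b₂
    far-injective {u₁ , v₁} {u₂ , v₂} b₁∈ b₂∈ same
      with proj₁ (L-spec u₁ v₁) b₁∈ | proj₁ (L-spec u₂ v₂) b₂∈
    ... | u₁<v₁ , br₁ | u₂<v₂ , br₂ with far-end-injective br₁ br₂ same
    ... | inj₁ (refl , refl) = refl
    ... | inj₂ (refl , refl) = ⊥-elim (<-asym u₁<v₁ u₂<v₂)
    disjoint : Disjoint (h ∷ t) (map (far-end h) L)
    disjoint (z∈C , z∈far) with ∈-map⁻ (far-end h) z∈far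
    ... | (u , v) , uv∈L , refl = far-end∉cycle cyc (proj₂ (proj₁ (L-spec u v) uv∈L)) z∈C

  off-cycle-edge⇒bridge : ∀ {D a b} → size G ≤ n → IsCycle G D → Adj G a b → ¬ CycEdge D a b → IsBridge G a b
  off-cycle-edge⇒bridge {D} {a} {b} m≤n cyc a~b ab∉D = a~b , λ detour₁ →
    let c , d , cd∈D = IsCycle⇒∃cycPair G cyc in
    <⇒≱ (two-non-bridges⇒order<size G connected a~b (CycEdge⇒Adj G cyc (inj₁ cd∈D))
           (λ ab~cd → ab∉D (CycEdge-resp G {D} (SameEdge-sym ab~cd) (inj₁ cd∈D)))
           detour₁
           (Reach-map (λ ((x~y , xy∈D) , xy≁cd) → (x~y , λ xy~ab → ab∉D (CycEdge-resp G {D} xy~ab xy∈D)) , xy≁cd)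
             (cycle-edge-detour G cyc (inj₁ cd∈D))))
        m≤n

  module _ {C : List (Fin n)} (m≤n : size G ≤ n) (cyc : IsCycle G C) where

    size≤bridges+cycle : ∀ {k} → HasBridges G k → size G ≤ k + length C
    size≤bridges+cycle {k} (L , _ , |L|≡k , L-spec) =
      subst (size G ≤_) (trans (length-++ L) (cong₂ _+_ |L|≡k (trans (length-map _ (cycPairs C)) (length-cycPairs C))))
        (Unique-length-≤ (Unique-edges G) classify)
      where
      classify : edges G ⊆ L ++ map (λ p → sortPair (proj₁ p) (proj₂ p)) (cycPairs C)
      classify {u , v} uv∈E with ∈-edges⁻ G uv∈E | (u , v) ∈ₚ? L
      ... | _ | yes uv∈L = ∈-++⁺ˡ uv∈L
      ... | u<v , u~v | no uv∉L with CycEdge? C u v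
      ... | yes (inj₁ uv∈C) = ∈-++⁺ʳ L (subst (_∈ _) (sortPair-< u<v) (∈-map⁺ _ uv∈C))
      ... | yes (inj₂ vu∈C) = ∈-++⁺ʳ L (subst (_∈ _) (sortPair-> u<v) (∈-map⁺ _ vu∈C))
      ... | no uv∉C = ⊥-elim (uv∉L (proj₂ (L-spec u v) (u<v , off-cycle-edge⇒bridge m≤n cyc u~v uv∉C)))

    cycle-unique : ∀ {D} → IsCycle G D → SameCycle C D
    cycle-unique {D} cyc′ a b = on-cycle⇒on-every-cycle cyc cyc′ , on-cycle⇒on-every-cycle cyc′ cyc
      where
      on-cycle⇒on-every-cycle : ∀ {C₁ C₂} → IsCycle G C₁ → IsCycle G C₂ → CycEdge C₁ a b → CycEdge C₂ a b
      on-cycle⇒on-every-cycle {C₁} {C₂} cyc₁ cyc₂ ab∈C₁ with CycEdge? C₂ a b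
      ... | yes ab∈C₂ = ab∈C₂
      ... | no ab∉C₂ = ⊥-elim (proj₂ (off-cycle-edge⇒bridge m≤n cyc₂ (CycEdge⇒Adj G cyc₁ ab∈C₁) ab∉C₂)
                                    (cycle-edge-nonbridge G cyc₁ ab∈C₁))

-- Bounds on the Sombor index

m*m≤n*n⇒m≤n : ∀ {m n} → m * m ≤ n * n → m ≤ n
m*m≤n*n⇒m≤n {m} {n} m²≤n² with m ≤? n
... | yes m≤n = m≤n
... | no m≰n = ⊥-elim (<⇒≱ (*-mono-< (≰⇒> m≰n) (≰⇒> m≰n)) m²≤n²)

m*m<n*n⇒m<n : ∀ {m n} → m * m < n * n → m < n
m*m<n*n⇒m<n {m} {n} m²<n² with n ≤? m
... | yes n≤m = ⊥-elim (<⇒≱ m²<n² (*-mono-≤ n≤m n≤m))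
... | no n≰m = ≰⇒> n≰m

isqrt-bounds : ∀ X → isqrt X * isqrt X ≤ X × X < suc (isqrt X) * suc (isqrt X)
isqrt-bounds X = go X (≤-trans (n<1+n X) (m≤m*n (suc X) (suc X)))
  where
  go : ∀ r → X < suc r * suc r → isqrtGo X r * isqrtGo X r ≤ X × X < suc (isqrtGo X r) * suc (isqrtGo X r)
  go zero X<1 = z≤n , X<1
  go (suc r) X<r² with (suc r * suc r) ≤ᵇ X in eq
  ... | true = ≤ᵇ⇒≤ (suc r * suc r) X (Equivalence.from T-≡ eq) , X<r²
  ... | false = go r (≰⇒> λ r²≤X → subst T eq (≤⇒≤ᵇ r²≤X))

isqrt-≤ : ∀ {X y} → X ≤ y * y → isqrt X ≤ y
isqrt-≤ {X} X≤y² = m*m≤n*n⇒m≤n (≤-trans (proj₁ (isqrt-bounds X)) X≤y²)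

≤-isqrt : ∀ {X y} → y * y ≤ X → y ≤ isqrt X
≤-isqrt {X} y²≤X = ≤-pred (m*m<n*n⇒m<n (≤-<-trans y²≤X (proj₂ (isqrt-bounds X))))

isqrt-mono-≤ : ∀ {X Y} → X ≤ Y → isqrt X ≤ isqrt Y
isqrt-mono-≤ {X} X≤Y = ≤-isqrt (≤-trans (proj₁ (isqrt-bounds X)) X≤Y)

[_]*_ : Bool → ℕ → ℕ
[ b ]* x = if b then x else 0

sumMap : ∀ {A : Set} → (A → ℕ) → List A → ℕ
sumMap f xs = sum (map f xs)

∑ᵥ : ∀ {n} → (Fin n → ℕ) → ℕ
∑ᵥ {n} f = sumMap f (allFin n)

module _ {A : Set} where

  sumMap-cong : ∀ {f g : A → ℕ} xs → (∀ x → f x ≡ g x) → sumMap f xs ≡ sumMap g xs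
  sumMap-cong [] _ = refl
  sumMap-cong (x ∷ xs) f≗g = cong₂ _+_ (f≗g x) (sumMap-cong xs f≗g)

  sumMap-mono-≤ : ∀ {f g : A → ℕ} xs → (∀ {x} → x ∈ xs → f x ≤ g x) → sumMap f xs ≤ sumMap g xs
  sumMap-mono-≤ [] _ = z≤n
  sumMap-mono-≤ (x ∷ xs) f≤g = +-mono-≤ (f≤g (here refl)) (sumMap-mono-≤ xs (f≤g ∘ there))

  sumMap-+ : ∀ (f g : A → ℕ) xs → sumMap (λ x → f x + g x) xs ≡ sumMap f xs + sumMap g xs
  sumMap-+ f g [] = refl
  sumMap-+ f g (x ∷ xs) = trans (cong (f x + g x +_) (sumMap-+ f g xs)) (+-swap-middle (f x) (g x) (sumMap f xs) (sumMap g xs))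
    where
    +-swap-middle : ∀ a b c d → a + b + (c + d) ≡ a + c + (b + d)
    +-swap-middle = solve-∀

  sumMap-*ˡ : ∀ (f : A → ℕ) c xs → c * sumMap f xs ≡ sumMap (λ x → c * f x) xs
  sumMap-*ˡ f c [] = *-zeroʳ c
  sumMap-*ˡ f c (x ∷ xs) = trans (*-distribˡ-+ c (f x) (sumMap f xs)) (cong (c * f x +_) (sumMap-*ˡ f c xs))

  sumMap-*ʳ : ∀ (f : A → ℕ) c xs → sumMap f xs * c ≡ sumMap (λ x → f x * c) xs
  sumMap-*ʳ f c [] = refl
  sumMap-*ʳ f c (x ∷ xs) = trans (*-distribʳ-+ c (f x) (sumMap f xs)) (cong (f x * c +_) (sumMap-*ʳ f c xs))

  sumMap-const : ∀ c (xs : List A) → sumMap (λ _ → c) xs ≡ c * length xs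
  sumMap-const c [] = sym (*-zeroʳ c)
  sumMap-const c (x ∷ xs) = trans (cong (c +_) (sumMap-const c xs)) (sym (*-suc c (length xs)))

  sumMap-zero : ∀ (xs : List A) → sumMap (λ _ → 0) xs ≡ 0
  sumMap-zero xs = trans (sumMap-const 0 xs) (*-zeroˡ (length xs))

  length-filterᵇ : ∀ (p : A → Bool) xs → length (filterᵇ p xs) ≡ sumMap (λ x → [ p x ]* 1) xs
  length-filterᵇ p [] = refl
  length-filterᵇ p (x ∷ xs) with p x
  ... | true = cong suc (length-filterᵇ p xs)
  ... | false = length-filterᵇ p xs

module _ {A B : Set} where

  sumMap-swap : ∀ (F : A → B → ℕ) xs ys → sumMap (λ x → sumMap (F x) ys) xs ≡ sumMap (λ y → sumMap (λ x → F x y) xs) ys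
  sumMap-swap F [] ys = sym (sumMap-zero ys)
  sumMap-swap F (x ∷ xs) ys = trans (cong (sumMap (F x) ys +_) (sumMap-swap F xs ys))
                                    (sym (sumMap-+ (F x) (λ y → sumMap (λ x → F x y) xs) ys))

  sumMap-concatMap : ∀ (F : B → ℕ) (h : A → List B) xs → sumMap F (concatMap h xs) ≡ sumMap (λ x → sumMap F (h x)) xs
  sumMap-concatMap F h [] = refl
  sumMap-concatMap F h (x ∷ xs) = trans (cong sum (map-++ F (h x) (concatMap h xs)))
    (trans (sum-++ (map F (h x)) (map F (concatMap h xs))) (cong (sumMap F (h x) +_) (sumMap-concatMap F h xs)))

  sumMap-map-filterᵇ : ∀ (F : A × B → ℕ) i (p : B → Bool) ys →
                       sumMap F (map (i ,_) (filterᵇ p ys)) ≡ sumMap (λ j → [ p j ]* F (i , j)) ys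
  sumMap-map-filterᵇ F i p [] = refl
  sumMap-map-filterᵇ F i p (y ∷ ys) with p y
  ... | true = cong (F (i , y) +_) (sumMap-map-filterᵇ F i p ys)
  ... | false = sumMap-map-filterᵇ F i p ys

module _ {n : ℕ} (G : Graph n) where

  private
    forward : Fin n → Fin n → Bool
    forward i j = (toℕ i <ᵇ toℕ j) ∧ adj G i j

    forward-split : ∀ i j x → [ forward i j ]* x + [ forward j i ]* x ≡ [ adj G i j ]* x
    forward-split i j x with <-cmp (toℕ i) (toℕ j)
    ... | tri< i<j _ _ rewrite <ᵇ-true i<j | <ᵇ-false (<⇒≤ i<j) = +-identityʳ _
    ... | tri> _ _ j<i rewrite <ᵇ-true j<i | <ᵇ-false (<⇒≤ j<i) | Graph.sym G j i = refl
    ... | tri≈ _ i≡j _ rewrite toℕ-injective i≡j | irrefl G j | <ᵇ-false (≤-refl {toℕ j}) = refl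

    if-+ : ∀ b x y → [ b ]* (x + y) ≡ [ b ]* x + [ b ]* y
    if-+ true x y = refl
    if-+ false x y = refl

    if-1* : ∀ b x → ([ b ]* 1) * x ≡ [ b ]* x
    if-1* true x = +-identityʳ x
    if-1* false x = refl

  handshake : ∀ (g : Fin n → ℕ) →
              sumMap (λ e → g (proj₁ e) + g (proj₂ e)) (edges G) ≡ ∑ᵥ (λ v → deg G v * g v)
  handshake g = begin
      sumMap F (edges G)
    ≡⟨ sumMap-concatMap F (λ i → map (i ,_) (filterᵇ (forward i) (allFin n))) (allFin n) ⟩
      ∑ᵥ (λ i → sumMap F (map (i ,_) (filterᵇ (forward i) (allFin n))))
    ≡⟨ sumMap-cong (allFin n) (λ i → sumMap-map-filterᵇ F i (forward i) (allFin n)) ⟩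
      ∑ᵥ (λ i → ∑ᵥ (λ j → [ forward i j ]* (g i + g j)))
    ≡⟨ sumMap-cong (allFin n) (λ i → trans (sumMap-cong (allFin n) (λ j → if-+ (forward i j) (g i) (g j)))
                                           (sumMap-+ _ _ (allFin n))) ⟩
      ∑ᵥ (λ i → ∑ᵥ (λ j → [ forward i j ]* g i) + ∑ᵥ (λ j → [ forward i j ]* g j))
    ≡⟨ sumMap-+ _ _ (allFin n) ⟩
      ∑ᵥ (λ i → ∑ᵥ (λ j → [ forward i j ]* g i)) + ∑ᵥ (λ i → ∑ᵥ (λ j → [ forward i j ]* g j))
    ≡⟨ cong (∑ᵥ (λ i → ∑ᵥ (λ j → [ forward i j ]* g i)) +_)
            (sumMap-swap (λ i j → [ forward i j ]* g j) (allFin n) (allFin n)) ⟩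
      ∑ᵥ (λ i → ∑ᵥ (λ j → [ forward i j ]* g i)) + ∑ᵥ (λ i → ∑ᵥ (λ j → [ forward j i ]* g i))
    ≡⟨ sym (sumMap-+ _ _ (allFin n)) ⟩
      ∑ᵥ (λ i → ∑ᵥ (λ j → [ forward i j ]* g i) + ∑ᵥ (λ j → [ forward j i ]* g i))
    ≡⟨ sumMap-cong (allFin n) (λ i → trans (sym (sumMap-+ _ _ (allFin n)))
                                           (sumMap-cong (allFin n) (λ j → forward-split i j (g i)))) ⟩
      ∑ᵥ (λ i → ∑ᵥ (λ j → [ adj G i j ]* g i))
    ≡⟨ sumMap-cong (allFin n) (λ i → trans (sumMap-cong (allFin n) (λ j → sym (if-1* (adj G i j) (g i))))
                                           (sym (sumMap-*ʳ (λ j → [ adj G i j ]* 1) (g i) (allFin n)))) ⟩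
      ∑ᵥ (λ i → ∑ᵥ (λ j → [ adj G i j ]* 1) * g i)
    ≡⟨ sumMap-cong (allFin n) (λ i → cong (_* g i) (sym (length-filterᵇ (adj G i) (allFin n)))) ⟩
      ∑ᵥ (λ v → deg G v * g v) ∎
    where
    open ≡-Reasoning
    F : Fin n × Fin n → ℕ
    F e = g (proj₁ e) + g (proj₂ e)

private
  square-of-sum≤-ordered : ∀ {a b} → a ≤ b → (a + b) * (a + b) ≤ 2 * (a * a + b * b)
  square-of-sum≤-ordered {a} a≤b with m≤n⇒∃[o]m+o≡n a≤b
  ... | d , refl = subst ((a + (a + d)) * (a + (a + d)) ≤_) (identity a d) (m≤m+n _ (d * d))
    where
    identity : ∀ a d → (a + (a + d)) * (a + (a + d)) + d * d ≡ 2 * (a * a + (a + d) * (a + d))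
    identity = solve-∀

square-of-sum≤ : ∀ a b → (a + b) * (a + b) ≤ 2 * (a * a + b * b)
square-of-sum≤ a b with ≤-total a b
... | inj₁ a≤b = square-of-sum≤-ordered a≤b
... | inj₂ b≤a = subst₂ _≤_ (cong₂ _*_ (+-comm b a) (+-comm b a)) (cong (2 *_) (+-comm (b * b) (a * a)))
                   (square-of-sum≤-ordered b≤a)

4*≤square+4 : ∀ d → 4 * d ≤ d * d + 4
4*≤square+4 0 = z≤n
4*≤square+4 1 = s≤s (s≤s (s≤s (s≤s z≤n)))
4*≤square+4 (suc (suc e)) = subst₂ _≤_ (identity₁ e) (sym (identity₂ e)) (m≤m+n (8 + 4 * e) (e * e))
  where
  identity₁ : ∀ e → 8 + 4 * e ≡ 4 * suc (suc e)
  identity₁ = solve-∀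
  identity₂ : ∀ e → suc (suc e) * suc (suc e) + 4 ≡ 8 + 4 * e + e * e
  identity₂ = solve-∀

-- (a + b)/√2 ≤ √(a² + b²) at scale N, where isqrt (8 * N * N) stands for √8·N.
edge-term-lower : ∀ a b N → (a + b) * isqrt (8 * N * N) < 4 * suc (isqrt ((a * a + b * b) * N * N))
edge-term-lower a b N = m*m<n*n⇒m<n (begin-strict
    ((a + b) * s) * ((a + b) * s)        ≡⟨ identity₁ (a + b) s ⟩
    ((a + b) * (a + b)) * (s * s)        ≤⟨ *-monoʳ-≤ ((a + b) * (a + b)) (proj₁ (isqrt-bounds (8 * N * N))) ⟩
    ((a + b) * (a + b)) * (8 * N * N)    ≤⟨ *-monoˡ-≤ (8 * N * N) (square-of-sum≤ a b) ⟩
    (2 * (a * a + b * b)) * (8 * N * N)  ≡⟨ identity₂ (a * a + b * b) N ⟩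
    16 * ((a * a + b * b) * N * N)       <⟨ *-monoʳ-< 16 (proj₂ (isqrt-bounds ((a * a + b * b) * N * N))) ⟩
    16 * (suc y * suc y)                 ≡⟨ identity₃ (suc y) ⟩
    (4 * suc y) * (4 * suc y)            ∎)
  where
  open ≤-Reasoning
  s = isqrt (8 * N * N)
  y = isqrt ((a * a + b * b) * N * N)
  identity₁ : ∀ c s → (c * s) * (c * s) ≡ (c * c) * (s * s)
  identity₁ = solve-∀
  identity₂ : ∀ q N → (2 * q) * (8 * N * N) ≡ 16 * (q * N * N)
  identity₂ = solve-∀
  identity₃ : ∀ z → 16 * (z * z) ≡ (4 * z) * (4 * z)
  identity₃ = solve-∀

-- SO(G) ≥ Σᵥ deg(v)²/√2 ≥ (8m − 4n)/√2 at scale N, via 4d ≤ d² + 4.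
SOfloor-lower : ∀ {n} (G : Graph n) N →
  isqrt (8 * N * N) * (8 * size G) ≤ 4 * SOfloor G N + 4 * size G + 4 * n * isqrt (8 * N * N)
SOfloor-lower {n} G N = begin
    s * (8 * m)
  ≡⟨ cong (s *_) (trans (identity₀ m) (cong (4 *_) (sym degree-sum))) ⟩
    s * (4 * ∑ᵥ (λ v → d v * 1))
  ≤⟨ *-monoʳ-≤ s (subst (_≤ ∑ᵥ (λ v → d v * d v + 4)) (sym (sumMap-*ˡ (λ v → d v * 1) 4 (allFin n)))
       (sumMap-mono-≤ (allFin n) λ {v} _ →
         subst (λ z → 4 * z ≤ d v * d v + 4) (sym (*-identityʳ (d v))) (4*≤square+4 (d v)))) ⟩
    s * ∑ᵥ (λ v → d v * d v + 4)
  ≡⟨ cong (s *_) (trans (sumMap-+ (λ v → d v * d v) (λ _ → 4) (allFin n))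
                        (cong (∑ᵥ (λ v → d v * d v) +_) (trans (sumMap-const 4 (allFin n)) (cong (4 *_) (length-allFin n))))) ⟩
    s * (∑ᵥ (λ v → d v * d v) + 4 * n)
  ≡⟨ cong (λ z → s * (z + 4 * n)) (sym (handshake G d)) ⟩
    s * (sumMap (λ e → d (proj₁ e) + d (proj₂ e)) (edges G) + 4 * n)
  ≡⟨ *-distribˡ-+ s _ (4 * n) ⟩
    s * sumMap (λ e → d (proj₁ e) + d (proj₂ e)) (edges G) + s * (4 * n)
  ≡⟨ cong₂ _+_ (trans (*-comm s _) (sumMap-*ʳ (λ e → d (proj₁ e) + d (proj₂ e)) s (edges G))) (identity₁ s n) ⟩
    sumMap (λ e → (d (proj₁ e) + d (proj₂ e)) * s) (edges G) + 4 * n * s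
  ≤⟨ +-monoˡ-≤ (4 * n * s) (sumMap-mono-≤ (edges G) λ {e} _ → <⇒≤ (edge-term-lower (d (proj₁ e)) (d (proj₂ e)) N)) ⟩
    sumMap (λ e → 4 * suc (F e)) (edges G) + 4 * n * s
  ≡⟨ cong (_+ 4 * n * s) (trans (sumMap-cong (edges G) (λ e → identity₂ (F e)))
       (trans (sumMap-+ (λ e → 4 * F e) (λ _ → 4) (edges G))
              (cong₂ _+_ (sym (sumMap-*ˡ F 4 (edges G))) (sumMap-const 4 (edges G))))) ⟩
    4 * SOfloor G N + 4 * m + 4 * n * s ∎
  where
  open ≤-Reasoning
  m = size G
  s = isqrt (8 * N * N)
  d = deg G
  F : Fin n × Fin n → ℕ
  F e = isqrt ((d (proj₁ e) * d (proj₁ e) + d (proj₂ e) * d (proj₂ e)) * N * N)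
  degree-sum : ∑ᵥ (λ v → d v * 1) ≡ 2 * m
  degree-sum = trans (sym (handshake G (λ _ → 1))) (sumMap-const 2 (edges G))
  identity₀ : ∀ m → 8 * m ≡ 4 * (2 * m)
  identity₀ = solve-∀
  identity₁ : ∀ s n → s * (4 * n) ≡ 4 * n * s
  identity₁ = solve-∀
  identity₂ : ∀ x → 4 * suc x ≡ 4 * x + 4
  identity₂ = solve-∀

∑ᵥ-suc : ∀ {n} (f : Fin (suc n) → ℕ) → ∑ᵥ f ≡ f Fin.zero + ∑ᵥ (f ∘ Fin.suc)
∑ᵥ-suc f = cong (f Fin.zero +_) (cong sum (trans (map-tabulate Fin.suc f) (sym (map-tabulate (λ v → v) (f ∘ Fin.suc)))))

∑ᵥ-indicator : ∀ {n} (f : Fin n → ℕ) w → ∑ᵥ (λ v → [ does (v ≟F w) ]* f v) ≡ f w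
∑ᵥ-indicator {suc n} f Fin.zero = trans (∑ᵥ-suc (λ v → [ does (v ≟F Fin.zero) ]* f v))
  (trans (cong (f Fin.zero +_) (sumMap-zero (allFin n))) (+-identityʳ _))
∑ᵥ-indicator {suc n} f (Fin.suc w) = trans (∑ᵥ-suc (λ v → [ does (v ≟F Fin.suc w) ]* f v)) (∑ᵥ-indicator (f ∘ Fin.suc) w)

module _ {n : ℕ} (H : Graph n) (w : Fin n) (deg-w≤3 : deg H w ≤ 3) (deg≤2 : ∀ v → v ≢ w → deg H v ≤ 2) where

  private
    at-w : Fin n → ℕ
    at-w v = [ does (v ≟F w) ]* 1

    deg*at-w : ∀ v → deg H v * at-w v ≡ [ does (v ≟F w) ]* deg H v
    deg*at-w v with v ≟F w
    ... | yes _ = *-identityʳ (deg H v)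
    ... | no _ = *-zeroʳ (deg H v)

    touches-w : Fin n × Fin n → ℕ
    touches-w e = at-w (proj₁ e) + at-w (proj₂ e)

    touching-edges≡deg : sumMap touches-w (edges H) ≡ deg H w
    touching-edges≡deg = trans (handshake H at-w) (trans (sumMap-cong (allFin n) deg*at-w) (∑ᵥ-indicator (deg H) w))

  size≤order : size H ≤ n
  size≤order = ≤-pred (*-cancelˡ-< 2 (size H) (suc n) (subst (2 * size H <_) (identity n) (s≤s degree-sum≤)))
    where
    open ≤-Reasoning
    deg≤2+at-w : ∀ v → deg H v * 1 ≤ at-w v + 2
    deg≤2+at-w v rewrite *-identityʳ (deg H v) with v ≟F w
    ... | yes refl = deg-w≤3
    ... | no v≢w = deg≤2 v v≢w
    degree-sum≤ : 2 * size H ≤ 1 + 2 * n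
    degree-sum≤ = begin
      2 * size H                  ≡⟨ sym (sumMap-const 2 (edges H)) ⟩
      sumMap (λ _ → 2) (edges H)  ≡⟨ handshake H (λ _ → 1) ⟩
      ∑ᵥ (λ v → deg H v * 1)      ≤⟨ sumMap-mono-≤ (allFin n) (λ {v} _ → deg≤2+at-w v) ⟩
      ∑ᵥ (λ v → at-w v + 2)       ≡⟨ sumMap-+ at-w (λ _ → 2) (allFin n) ⟩
      ∑ᵥ at-w + ∑ᵥ {n} (λ _ → 2)  ≡⟨ cong₂ _+_ (∑ᵥ-indicator (λ _ → 1) w)
                                               (trans (sumMap-const 2 (allFin n)) (cong (2 *_) (length-allFin n))) ⟩
      1 + 2 * n                   ∎
    identity : ∀ n → suc (1 + 2 * n) ≡ 2 * suc n
    identity = solve-∀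

  -- SO(H) ≤ √8·|E(H)| + 3(4 − √8) at scale N: at most three edges meet w, each with √13 < 4.
  SOfloor-upper : ∀ N → SOfloor H N + 3 * isqrt (8 * N * N) ≤ size H * isqrt (8 * N * N) + 12 * N
  SOfloor-upper N = begin
      SOfloor H N + 3 * s
    ≤⟨ +-monoˡ-≤ (3 * s) (sumMap-mono-≤ (edges H) edge-term≤) ⟩
      sumMap (λ e → s + touches-w e * (4 * N ∸ s)) (edges H) + 3 * s
    ≡⟨ cong (_+ 3 * s) (trans (sumMap-+ (λ _ → s) _ (edges H))
         (cong₂ _+_ (trans (sumMap-const s (edges H)) (*-comm s (size H)))
                    (trans (sym (sumMap-*ʳ touches-w (4 * N ∸ s) (edges H))) (cong (_* (4 * N ∸ s)) touching-edges≡deg)))) ⟩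
      size H * s + deg H w * (4 * N ∸ s) + 3 * s
    ≤⟨ +-monoˡ-≤ (3 * s) (+-monoʳ-≤ (size H * s) (*-monoˡ-≤ (4 * N ∸ s) deg-w≤3)) ⟩
      size H * s + 3 * (4 * N ∸ s) + 3 * s
    ≡⟨ trans (+-assoc (size H * s) _ _)
             (cong (size H * s +_) (trans (sym (*-distribˡ-+ 3 (4 * N ∸ s) s)) (cong (3 *_) (m∸n+n≡m s≤4N)))) ⟩
      size H * s + 3 * (4 * N)
    ≡⟨ cong (size H * s +_) (identity N) ⟩
      size H * s + 12 * N ∎
    where
    open ≤-Reasoning
    s = isqrt (8 * N * N)
    d = deg H
    identity : ∀ N → 3 * (4 * N) ≡ 12 * N
    identity = solve-∀
    square-N : ∀ N → 16 * N * N ≡ 4 * N * (4 * N)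
    square-N = solve-∀
    s≤4N : s ≤ 4 * N
    s≤4N = isqrt-≤ (subst (8 * N * N ≤_) (square-N N) (*-monoˡ-≤ N (*-monoˡ-≤ N (≤ᵇ⇒≤ 8 16 _))))
    at-w-term≤ : ∀ {a b} → a ≤ 3 → b ≤ 2 → isqrt ((a * a + b * b) * N * N) ≤ 4 * N
    at-w-term≤ {a} {b} a≤3 b≤2 = isqrt-≤ (subst ((a * a + b * b) * N * N ≤_) (square-N N)
      (*-monoˡ-≤ N (*-monoˡ-≤ N (≤-trans (+-mono-≤ (*-mono-≤ a≤3 a≤3) (*-mono-≤ b≤2 b≤2)) (≤ᵇ⇒≤ 13 16 _)))))
    via-w : ∀ {x} → x ≤ 4 * N → x ≤ s + (4 * N ∸ s + 0)
    via-w {x} = subst (x ≤_) (sym (trans (cong (s +_) (+-identityʳ _)) (m+[n∸m]≡n s≤4N)))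
    term : Fin n × Fin n → ℕ
    term (u , v) = isqrt ((d u * d u + d v * d v) * N * N)
    edge-term≤ : ∀ {e} → e ∈ edges H → term e ≤ s + touches-w e * (4 * N ∸ s)
    edge-term≤ {u , v} uv∈E with u ≟F w | v ≟F w
    ... | yes refl | yes refl = ⊥-elim (<-irrefl refl (proj₁ (∈-edges⁻ H uv∈E)))
    ... | yes refl | no v≢w = via-w (at-w-term≤ deg-w≤3 (deg≤2 v v≢w))
    ... | no u≢w | yes refl =
      via-w (subst (λ z → isqrt (z * N * N) ≤ 4 * N) (+-comm (d v * d v) (d u * d u)) (at-w-term≤ deg-w≤3 (deg≤2 u u≢w)))
    ... | no u≢w | no v≢w = subst (term (u , v) ≤_) (sym (+-identityʳ s)) (isqrt-mono-≤ (*-monoˡ-≤ N (*-monoˡ-≤ N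
                              (+-mono-≤ (*-mono-≤ (deg≤2 u u≢w) (deg≤2 u u≢w)) (*-mono-≤ (deg≤2 v v≢w) (deg≤2 v v≢w))))))

  private
    combined-bounds : ∀ {n m m′ SΓ SH s N} →
      s * (8 * m) ≤ 4 * SΓ + 4 * m + 4 * n * s → SΓ ≤ SH + m′ → SH + 3 * s ≤ m′ * s + 12 * N →
      m′ ≤ n → suc n ≤ m → 20 * s ≤ 48 * N + (4 * n + 4 * m)
    combined-bounds {n} {m} {m′} {SΓ} {SH} {s} {N} lowerΓ minimal upperH m′≤n n<m = +-cancelˡ-≤ (8 * n * s) _ _ (begin
        8 * n * s + 20 * s
      ≡⟨ identity₁ n s ⟩
        8 * suc n * s + 12 * s
      ≤⟨ +-monoˡ-≤ (12 * s) (*-monoˡ-≤ s (*-monoʳ-≤ 8 n<m)) ⟩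
        8 * m * s + 12 * s
      ≡⟨ cong (_+ 12 * s) (identity₂ m s) ⟩
        s * (8 * m) + 12 * s
      ≤⟨ +-monoˡ-≤ (12 * s) lowerΓ ⟩
        4 * SΓ + 4 * m + 4 * n * s + 12 * s
      ≤⟨ +-monoˡ-≤ (12 * s) (+-monoˡ-≤ (4 * n * s) (+-monoˡ-≤ (4 * m) (*-monoʳ-≤ 4 minimal))) ⟩
        4 * (SH + m′) + 4 * m + 4 * n * s + 12 * s
      ≡⟨ identity₃ SH m′ m n s ⟩
        4 * (SH + 3 * s) + 4 * m′ + 4 * m + 4 * n * s
      ≤⟨ +-monoˡ-≤ (4 * n * s) (+-monoˡ-≤ (4 * m) (+-mono-≤ (*-monoʳ-≤ 4 upperH) (*-monoʳ-≤ 4 m′≤n))) ⟩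
        4 * (m′ * s + 12 * N) + 4 * n + 4 * m + 4 * n * s
      ≤⟨ +-monoˡ-≤ (4 * n * s) (+-monoˡ-≤ (4 * m) (+-monoˡ-≤ (4 * n)
           (*-monoʳ-≤ 4 (+-monoˡ-≤ (12 * N) (*-monoˡ-≤ s m′≤n))))) ⟩
        4 * (n * s + 12 * N) + 4 * n + 4 * m + 4 * n * s
      ≡⟨ identity₄ n s N m ⟩
        8 * n * s + (48 * N + (4 * n + 4 * m)) ∎)
      where
      open ≤-Reasoning
      identity₁ : ∀ n s → 8 * n * s + 20 * s ≡ 8 * suc n * s + 12 * s
      identity₁ = solve-∀
      identity₂ : ∀ m s → 8 * m * s ≡ s * (8 * m)
      identity₂ = solve-∀
      identity₃ : ∀ SH m′ m n s → 4 * (SH + m′) + 4 * m + 4 * n * s + 12 * s ≡ 4 * (SH + 3 * s) + 4 * m′ + 4 * m + 4 * n * s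
      identity₃ = solve-∀
      identity₄ : ∀ n s N m → 4 * (n * s + 12 * N) + 4 * n + 4 * m + 4 * n * s ≡ 8 * n * s + (48 * N + (4 * n + 4 * m))
      identity₄ = solve-∀

  -- The scale N = 5(n + m + 1) makes the rounding, at most one unit per edge, negligible.
  more-edges⇒¬SO≤ : ∀ (Γ : Graph n) → n < size Γ → ¬ SO≤ Γ H
  more-edges⇒¬SO≤ Γ n<m Γ≤H = 1+n≰n (≤-trans 4n+4m<40t
    (+-cancelˡ-≤ (240 * t) (40 * t) (4 * n + 4 * m) (subst (_≤ 240 * t + (4 * n + 4 * m)) (identity₂ t) 280t≤)))
    where
    m = size Γ
    t = n + m + 1
    N = 5 * t
    s = isqrt (8 * N * N)
    identity₀ : ∀ t → 14 * t * (14 * t) ≡ 196 * (t * t)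
    identity₀ = solve-∀
    identity₁ : ∀ t → 8 * (5 * t) * (5 * t) ≡ 200 * (t * t)
    identity₁ = solve-∀
    identity₂ : ∀ t → 20 * (14 * t) ≡ 240 * t + 40 * t
    identity₂ = solve-∀
    identity₃ : ∀ t → 48 * (5 * t) ≡ 240 * t
    identity₃ = solve-∀
    identity₄ : ∀ n m → suc (4 * n + 4 * m) + (36 * n + 36 * m + 39) ≡ 40 * (n + m + 1)
    identity₄ = solve-∀
    14t≤s : 14 * t ≤ s
    14t≤s = ≤-isqrt (subst₂ _≤_ (sym (identity₀ t)) (sym (identity₁ t)) (*-monoˡ-≤ (t * t) (≤ᵇ⇒≤ 196 200 _)))
    280t≤ : 20 * (14 * t) ≤ 240 * t + (4 * n + 4 * m)
    280t≤ = ≤-trans (*-monoʳ-≤ 20 14t≤s)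
              (subst (20 * s ≤_) (cong (_+ (4 * n + 4 * m)) (identity₃ t))
                (combined-bounds {N = N} (SOfloor-lower Γ N) (Γ≤H N) (SOfloor-upper N) size≤order n<m))
    4n+4m<40t : 4 * n + 4 * m < 40 * t
    4n+4m<40t = subst (suc (4 * n + 4 * m) ≤_) (identity₄ n m) (m≤m+n _ _)

-- The tadpole graph: vertices 0, …, c form a cycle (edges i ~ i + 1 and the chord 0 ~ c) and
-- c, …, n − 1 a pendant path, whose k edges are exactly the bridges.
module Tadpole (c k n : ℕ) (2≤c : 2 ≤ c) (n≡ : suc c + k ≡ n) where

  data TadpoleAdj (x y : ℕ) : Set where
    forward : y ≡ suc x → TadpoleAdj x y
    backward : x ≡ suc y → TadpoleAdj x y
    chord : x ≡ 0 → y ≡ c → TadpoleAdj x y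
    chord⁻ : x ≡ c → y ≡ 0 → TadpoleAdj x y

  TadpoleAdj-sym : ∀ {x y} → TadpoleAdj x y → TadpoleAdj y x
  TadpoleAdj-sym (forward y≡1+x) = backward y≡1+x
  TadpoleAdj-sym (backward x≡1+y) = forward x≡1+y
  TadpoleAdj-sym (chord x≡0 y≡c) = chord⁻ y≡c x≡0
  TadpoleAdj-sym (chord⁻ x≡c y≡0) = chord y≡0 x≡c

  c≢0 : c ≢ 0
  c≢0 c≡0 = <⇒≱ 2≤c (≤-trans (≤-reflexive c≡0) z≤n)

  c≢1 : c ≢ 1
  c≢1 c≡1 = <⇒≱ 2≤c (≤-reflexive c≡1)

  TadpoleAdj-irrefl : ∀ {x} → ¬ TadpoleAdj x x
  TadpoleAdj-irrefl (forward x≡1+x) = 1+n≢n (sym x≡1+x)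
  TadpoleAdj-irrefl (backward x≡1+x) = 1+n≢n (sym x≡1+x)
  TadpoleAdj-irrefl (chord x≡0 x≡c) = c≢0 (trans (sym x≡c) x≡0)
  TadpoleAdj-irrefl (chord⁻ x≡c x≡0) = c≢0 (trans (sym x≡c) x≡0)

  tadpoleAdj? : ∀ x y → Dec (TadpoleAdj x y)
  tadpoleAdj? x y with y ≟ suc x | x ≟ suc y | (x ≟ 0) ×-dec (y ≟ c) | (x ≟ c) ×-dec (y ≟ 0)
  ... | yes y≡1+x | _ | _ | _ = yes (forward y≡1+x)
  ... | no _ | yes x≡1+y | _ | _ = yes (backward x≡1+y)
  ... | no _ | no _ | yes (x≡0 , y≡c) | _ = yes (chord x≡0 y≡c)
  ... | no _ | no _ | no _ | yes (x≡c , y≡0) = yes (chord⁻ x≡c y≡0)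
  ... | no ¬f | no ¬b | no ¬ch | no ¬ch⁻ = no λ where
    (forward y≡1+x) → ¬f y≡1+x
    (backward x≡1+y) → ¬b x≡1+y
    (chord x≡0 y≡c) → ¬ch (x≡0 , y≡c)
    (chord⁻ x≡c y≡0) → ¬ch⁻ (x≡c , y≡0)

  H : Graph n
  H = record
    { adj = λ i j → does (tadpoleAdj? (toℕ i) (toℕ j))
    ; sym = λ i j → adj-sym (toℕ i) (toℕ j)
    ; irrefl = λ i → dec-false (tadpoleAdj? (toℕ i) (toℕ i)) TadpoleAdj-irrefl
    }
    where
    adj-sym : ∀ x y → does (tadpoleAdj? x y) ≡ does (tadpoleAdj? y x)
    adj-sym x y with tadpoleAdj? y x
    ... | yes yx = dec-true (tadpoleAdj? x y) (TadpoleAdj-sym yx)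
    ... | no ¬yx = dec-false (tadpoleAdj? x y) (¬yx ∘ TadpoleAdj-sym)

  Adj⇒TadpoleAdj : ∀ {i j} → Adj H i j → TadpoleAdj (toℕ i) (toℕ j)
  Adj⇒TadpoleAdj {i} {j} i~j with tadpoleAdj? (toℕ i) (toℕ j) | i~j
  ... | yes ij | _ = ij

  TadpoleAdj⇒Adj : ∀ {i j} → TadpoleAdj (toℕ i) (toℕ j) → Adj H i j
  TadpoleAdj⇒Adj {i} {j} = dec-true (tadpoleAdj? (toℕ i) (toℕ j))

  c<n : c < n
  c<n = subst (c <_) n≡ (s≤s (m≤m+n c k))

  w : Fin n
  w = fromℕ< c<n

  toℕ-w : toℕ w ≡ c
  toℕ-w = toℕ-fromℕ< c<n

  deg-w≤3 : deg H w ≤ 3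
  deg-w≤3 = deg≤length H w (suc c ∷ pred c ∷ 0 ∷ [])
    (λ w~j → neighbours-of-c (subst (λ x → TadpoleAdj x _) toℕ-w (Adj⇒TadpoleAdj w~j)))
    where
    neighbours-of-c : ∀ {y} → TadpoleAdj c y → y ∈ suc c ∷ pred c ∷ 0 ∷ []
    neighbours-of-c (forward refl) = here refl
    neighbours-of-c (backward c≡1+y) = there (here (sym (cong pred c≡1+y)))
    neighbours-of-c (chord c≡0 _) = ⊥-elim (c≢0 c≡0)
    neighbours-of-c (chord⁻ _ refl) = there (there (here refl))

  deg≤2 : ∀ v → v ≢ w → deg H v ≤ 2
  deg≤2 v v≢w = deg≤length H v (suc (toℕ v) ∷ down (toℕ v) ∷ []) (neighbours toℕv≢c ∘ Adj⇒TadpoleAdj)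
    where
    toℕv≢c : toℕ v ≢ c
    toℕv≢c toℕv≡c = v≢w (toℕ-injective (trans toℕv≡c (sym toℕ-w)))
    down : ℕ → ℕ
    down zero = c
    down (suc x) = x
    neighbours : ∀ {x y} → x ≢ c → TadpoleAdj x y → y ∈ suc x ∷ down x ∷ []
    neighbours _ (forward refl) = here refl
    neighbours _ (backward refl) = there (here refl)
    neighbours _ (chord refl refl) = there (here refl)
    neighbours x≢c (chord⁻ x≡c _) = ⊥-elim (x≢c x≡c)

  Ascent : ℕ → ℕ → Fin n → Fin n → Set
  Ascent lo hi a b = toℕ b ≡ suc (toℕ a) × lo ≤ toℕ a × toℕ b ≤ hi

  ascend : ∀ {lo} hi → (lo≤hi : lo ≤ hi) (hi<n : hi < n) →
           Reach (Ascent lo hi) (fromℕ< (≤-<-trans lo≤hi hi<n)) (fromℕ< hi<n)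
  ascend zero z≤n _ = here
  ascend {lo} (suc hi) lo≤1+hi 1+hi<n with m≤n⇒m<n∨m≡n lo≤1+hi
  ... | inj₂ refl = here
  ... | inj₁ (s≤s lo≤hi) = Reach-++ (Reach-map widen (ascend hi lo≤hi hi<n)) (step last-step here)
    where
    hi<n : hi < n
    hi<n = <-trans (n<1+n hi) 1+hi<n
    widen : ∀ {a b} → Ascent lo hi a b → Ascent lo (suc hi) a b
    widen (b≡1+a , lo≤a , b≤hi) = b≡1+a , lo≤a , m≤n⇒m≤1+n b≤hi
    last-step : Ascent lo (suc hi) (fromℕ< hi<n) (fromℕ< 1+hi<n)
    last-step = trans (toℕ-fromℕ< 1+hi<n) (cong suc (sym (toℕ-fromℕ< hi<n))) ,
                subst (lo ≤_) (sym (toℕ-fromℕ< hi<n)) lo≤hi , ≤-reflexive (toℕ-fromℕ< 1+hi<n)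

  Ascent⇒Adj : ∀ {lo hi a b} → Ascent lo hi a b → Adj H a b
  Ascent⇒Adj {a = a} {b} (b≡1+a , _) = TadpoleAdj⇒Adj {a} {b} (forward b≡1+a)

  0<n : 0 < n
  0<n = ≤-<-trans z≤n c<n

  v₀ : Fin n
  v₀ = fromℕ< 0<n

  ascend-to : ∀ v → Reach (Ascent 0 (toℕ v)) v₀ v
  ascend-to v = subst (Reach (Ascent 0 (toℕ v)) v₀) (fromℕ<-toℕ v (toℕ<n v)) (ascend (toℕ v) z≤n (toℕ<n v))

  connected : Connected H
  connected u v = Reach-++ (Reach-sym {R = Adj H} (λ {a} {b} → Adj-sym H {a} {b}) (ascent-walk (ascend-to u)))
                           (ascent-walk (ascend-to v))
    where
    ascent-walk : ∀ {lo hi s t} → Reach (Ascent lo hi) s t → Reach (Adj H) s t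
    ascent-walk = Reach-map λ {a} {b} → Ascent⇒Adj {a = a} {b}

  ascent-edge-within : ∀ {lo hi a b u v} → toℕ v ≡ suc (toℕ u) → Ascent lo hi a b → SameEdge (a , b) (u , v) →
                       lo ≤ toℕ u × toℕ v ≤ hi
  ascent-edge-within _ (_ , lo≤a , b≤hi) (inj₁ (refl , refl)) = lo≤a , b≤hi
  ascent-edge-within v≡1+u (b≡1+a , _) (inj₂ (refl , refl)) = ⊥-elim (n≢2+n (trans b≡1+a (cong suc v≡1+u)))
    where
    n≢2+n : ∀ {m} → m ≢ suc (suc m)
    n≢2+n {suc m} eq = n≢2+n (suc-injective eq)

  ascent-not-chord : ∀ {lo hi a b u v} → toℕ u ≡ 0 → toℕ v ≡ c → Ascent lo hi a b → ¬ SameEdge (a , b) (u , v)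
  ascent-not-chord u≡0 v≡c (b≡1+a , _) (inj₁ (refl , refl)) = c≢1 (trans (sym v≡c) (trans b≡1+a (cong suc u≡0)))
  ascent-not-chord u≡0 v≡c (b≡1+a , _) (inj₂ (refl , refl)) = 1+n≢0 (trans (sym b≡1+a) u≡0)

  ascent-avoiding : ∀ {lo hi u v s t} → (∀ {a b} → Ascent lo hi a b → ¬ SameEdge (a , b) (u , v)) →
                    Reach (Ascent lo hi) s t → Reach (AdjMinus H u v) s t
  ascent-avoiding avoids = Reach-map λ {a} {b} asc → Ascent⇒Adj {a = a} {b} asc , avoids asc

  descent-avoiding : ∀ {lo hi u v s t} → (∀ {a b} → Ascent lo hi a b → ¬ SameEdge (a , b) (u , v)) →
                     Reach (Ascent lo hi) s t → Reach (AdjMinus H u v) t s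
  descent-avoiding avoids = Reach-sym (AdjMinus-sym H) ∘ ascent-avoiding avoids

  chord-nonbridge : ∀ {u v} → toℕ u ≡ 0 → toℕ v ≡ c → Reach (AdjMinus H u v) u v
  chord-nonbridge {u} {v} u≡0 v≡c =
    subst₂ (Reach (AdjMinus H u v)) (toℕ-injective (trans (toℕ-fromℕ< _) (sym u≡0))) (toℕ-injective (trans toℕ-w (sym v≡c)))
      (ascent-avoiding (ascent-not-chord u≡0 v≡c) (ascend c z≤n c<n))

  -- Down from u to 0, across the chord to c, and down to v.
  cycle-path-nonbridge : ∀ {u v} → toℕ v ≡ suc (toℕ u) → toℕ v ≤ c → Reach (AdjMinus H u v) u v
  cycle-path-nonbridge {u} {v} v≡1+u v≤c =
    Reach-++ (descent-avoiding below (ascend-to u))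
      (step chord-step (subst (Reach (AdjMinus H u v) w) (fromℕ<-toℕ v (toℕ<n v)) (descent-avoiding above (ascend c v≤c c<n))))
    where
    below : ∀ {a b} → Ascent 0 (toℕ u) a b → ¬ SameEdge (a , b) (u , v)
    below asc ab~uv = 1+n≰n (subst (_≤ toℕ u) v≡1+u (proj₂ (ascent-edge-within v≡1+u asc ab~uv)))
    above : ∀ {a b} → Ascent (toℕ v) c a b → ¬ SameEdge (a , b) (u , v)
    above asc ab~uv = 1+n≰n (subst (_≤ toℕ u) v≡1+u (proj₁ (ascent-edge-within v≡1+u asc ab~uv)))
    chord-step : AdjMinus H u v v₀ w
    chord-step = TadpoleAdj⇒Adj {v₀} {w} (chord (toℕ-fromℕ< 0<n) toℕ-w) , λ where
      (inj₁ (refl , refl)) → c≢1 (trans (sym toℕ-w) (trans v≡1+u (cong suc (toℕ-fromℕ< 0<n))))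
      (inj₂ (refl , refl)) → 1+n≢0 (trans (sym v≡1+u) (toℕ-fromℕ< 0<n))

  pendant-walk-stays-below : ∀ {u v} → c ≤ toℕ u → toℕ v ≡ suc (toℕ u) →
                             ∀ {a b} → Reach (AdjMinus H u v) a b → toℕ a ≤ toℕ u → toℕ b ≤ toℕ u
  pendant-walk-stays-below c≤u v≡1+u here a≤u = a≤u
  pendant-walk-stays-below {u} {v} c≤u v≡1+u {a} (step {v = a′} (a~a′ , aa′≁uv) walk) a≤u =
    pendant-walk-stays-below c≤u v≡1+u walk (next (Adj⇒TadpoleAdj a~a′))
    where
    next : TadpoleAdj (toℕ a) (toℕ a′) → toℕ a′ ≤ toℕ u
    next (forward a′≡1+a) with m≤n⇒m<n∨m≡n a≤u
    ... | inj₁ a<u = subst (_≤ toℕ u) (sym a′≡1+a) a<u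
    ... | inj₂ a≡u =
      ⊥-elim (aa′≁uv (inj₁ (toℕ-injective a≡u , toℕ-injective (trans a′≡1+a (trans (cong suc a≡u) (sym v≡1+u))))))
    next (backward a≡1+a′) = ≤-trans (n≤1+n _) (subst (_≤ toℕ u) a≡1+a′ a≤u)
    next (chord _ a′≡c) = subst (_≤ toℕ u) (sym a′≡c) c≤u
    next (chord⁻ _ a′≡0) = subst (_≤ toℕ u) (sym a′≡0) z≤n

  pendant-bound : ∀ {d} → d < k → suc (c + d) < n
  pendant-bound d<k = subst (suc (c + _) <_) n≡ (s≤s (+-monoʳ-< c d<k))

  pendant : Fin k → Fin n × Fin n
  pendant j = fromℕ< (<-trans (n<1+n _) (pendant-bound (toℕ<n j))) , fromℕ< (pendant-bound (toℕ<n j))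

  pendant-start : ∀ j → toℕ (proj₁ (pendant j)) ≡ c + toℕ j
  pendant-start j = toℕ-fromℕ< _

  pendant-step : ∀ j → toℕ (proj₂ (pendant j)) ≡ suc (toℕ (proj₁ (pendant j)))
  pendant-step j = trans (toℕ-fromℕ< _) (cong suc (sym (pendant-start j)))

  pendant-injective : ∀ {i j} → pendant i ≡ pendant j → i ≡ j
  pendant-injective {i} {j} eq = toℕ-injective (+-cancelˡ-≡ c (toℕ i) (toℕ j)
    (trans (sym (pendant-start i)) (trans (cong (toℕ ∘ proj₁) eq) (pendant-start j))))

  OrderedBridge : Fin n × Fin n → Set
  OrderedBridge (u , v) = toℕ u < toℕ v × IsBridge H u v

  pendant-bridge : ∀ j → OrderedBridge (pendant j)
  pendant-bridge j = ≤-reflexive (sym (pendant-step j)) , TadpoleAdj⇒Adj {u} {v} (forward (pendant-step j)) ,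
    λ detour → 1+n≰n (subst (_≤ toℕ u) (pendant-step j) (pendant-walk-stays-below c≤u (pendant-step j) detour ≤-refl))
    where
    u = proj₁ (pendant j)
    v = proj₂ (pendant j)
    c≤u : c ≤ toℕ u
    c≤u = subst (c ≤_) (sym (pendant-start j)) (m≤m+n c (toℕ j))

  bridge-pendant : ∀ {u v} → OrderedBridge (u , v) → (u , v) ∈ map pendant (allFin k)
  bridge-pendant {u} {v} (u<v , u~v , ¬detour) with Adj⇒TadpoleAdj u~v
  ... | backward u≡1+v = ⊥-elim (<-asym u<v (subst (toℕ v <_) (sym u≡1+v) ≤-refl))
  ... | chord u≡0 v≡c = ⊥-elim (¬detour (chord-nonbridge u≡0 v≡c))
  ... | chord⁻ _ v≡0 = ⊥-elim (<⇒≱ u<v (subst (_≤ toℕ u) (sym v≡0) z≤n))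
  ... | forward v≡1+u with c ≤? toℕ u
  ... | no c≰u = ⊥-elim (¬detour (cycle-path-nonbridge v≡1+u (subst (_≤ c) (sym v≡1+u) (≰⇒> c≰u))))
  ... | yes c≤u = subst (_∈ map pendant (allFin k)) (sym uv≡) (∈-map⁺ pendant (∈-allFin j))
    where
    d = toℕ u ∸ c
    c+d≡u : c + d ≡ toℕ u
    c+d≡u = m+[n∸m]≡n c≤u
    d<k : d < k
    d<k = +-cancelˡ-< c d k (≤-pred (subst₂ _≤_ (cong suc (trans v≡1+u (cong suc (sym c+d≡u)))) (sym n≡) (toℕ<n v)))
    j : Fin k
    j = fromℕ< d<k
    u≡ : toℕ u ≡ toℕ (proj₁ (pendant j))
    u≡ = trans (sym c+d≡u) (trans (cong (c +_) (sym (toℕ-fromℕ< d<k))) (sym (pendant-start j)))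
    uv≡ : (u , v) ≡ pendant j
    uv≡ = cong₂ _,_ (toℕ-injective u≡) (toℕ-injective (trans v≡1+u (trans (cong suc u≡) (sym (pendant-step j)))))

  has-k-bridges : HasBridges H k
  has-k-bridges = map pendant (allFin k) , map⁺ pendant-injective (allFin⁺ k) ,
                  trans (length-map pendant (allFin k)) (length-allFin k) ,
                  λ u v → (λ uv∈ → pendant∈⇒bridge uv∈) , bridge-pendant
    where
    pendant∈⇒bridge : ∀ {u v} → (u , v) ∈ map pendant (allFin k) → OrderedBridge (u , v)
    pendant∈⇒bridge uv∈ with ∈-map⁻ pendant uv∈
    ... | j , _ , refl = pendant-bridge j

SO-minimal⇒size≤order : ∀ {n k} (Γ : Graph n) → 3 + k ≤ n →
                        ((Γ′ : Graph n) → Connected Γ′ → HasBridges Γ′ k → SO≤ Γ Γ′) → size Γ ≤ n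
SO-minimal⇒size≤order {n} {k} Γ 3+k≤n minimal with size Γ ≤? n
... | yes m≤n = m≤n
... | no m≰n = ⊥-elim (more-edges⇒¬SO≤ H w deg-w≤3 deg≤2 Γ (≰⇒> m≰n) (minimal H connected has-k-bridges))
  where
  c = n ∸ suc k
  2≤c : 2 ≤ c
  2≤c = subst (_≤ c) (m+n∸n≡m 2 (suc k)) (∸-monoˡ-≤ (suc k) 3+k≤n)
  n≡ : suc c + k ≡ n
  n≡ = trans (sym (+-suc c k)) (m∸n+n≡m (≤-trans (m≤n+m (suc k) 2) 3+k≤n))
  open Tadpole c k n 2≤c n≡

lemma3p5 : (n k : ℕ) → k < n ∸ 1 → (Γ : Graph n) → Connected Γ → HasBridges Γ k
    → ((Γ' : Graph n) → Connected Γ' → HasBridges Γ' k → SO≤ Γ Γ')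
    → Σ (List (Fin n)) (λ C → IsCycle Γ C × length C ≡ n ∸ k
        × ((D : List (Fin n)) → IsCycle Γ D → SameCycle C D))
lemma3p5 n k k<n-1 Γ connected bridges minimal = conclude (order≤size⇒cycle Γ connected (fromℕ< 0<n) n≤m)
  where
  0<n : 0 < n
  0<n = ≤-<-trans z≤n (<-≤-trans k<n-1 (m∸n≤m n 1))
  n≤m : n ≤ size Γ
  n≤m = few-bridges⇒order≤size Γ connected bridges k<n-1
  conclude : ∃ (IsCycle Γ) →
             Σ (List (Fin n)) (λ C → IsCycle Γ C × length C ≡ n ∸ k × ((D : List (Fin n)) → IsCycle Γ D → SameCycle C D))
  conclude (C , cyc) = C , cyc , |C|≡n∸k , λ D → cycle-unique Γ connected m≤n cyc
    where
    |C|+k≤n : length C + k ≤ n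
    |C|+k≤n = cycle+bridges≤order Γ connected cyc bridges
    m≤n : size Γ ≤ n
    m≤n = SO-minimal⇒size≤order Γ (≤-trans (+-monoˡ-≤ k (proj₁ cyc)) |C|+k≤n) minimal
    n≤|C|+k : n ≤ length C + k
    n≤|C|+k = ≤-trans n≤m (subst (size Γ ≤_) (+-comm k (length C)) (size≤bridges+cycle Γ connected m≤n cyc bridges))
    |C|≡n∸k : length C ≡ n ∸ k
    |C|≡n∸k = trans (sym (m+n∸n≡m (length C) k)) (cong (_∸ k) (≤-antisym |C|+k≤n n≤|C|+k))
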